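{- Let $\mathcal C$ be an irredundant coherent configuration. 1. For a set $S$ of edges of the fiber graph $\Gamma(\mathcal C)$, $f_S$ is a strict algebraic automorphism of $\mathcal C$ if and only if, for every $C\in\mathcal D(\mathcal C)$, the set $S\cap\binom C2$ is either empty or forms a spanning bipartite subgraph of the complete graph on the vertex set $C$. 2. The group of strict algebraic automorphisms of $\mathcal C$ is generated by the set of all $f_{X,C}$ with $C\in\mathcal D(\mathcal C)$ and $X\in C$.
   Context: A coherent configuration on a finite set $V$ is a partition $\mathcal C$ of $V\times V$ into basis relations such that: (A) a basis relation containing a loop consists of loops; (B) the transpose of a basis relation is a basis relation; (C) for all $R,S,T\in\mathcal C$ the number $|\{w:uw\in R,wv\in S\}|$ is the same for all $uv\in T$, denoted $p^T_{RS}$. Fibers are sets $X$ with $\{xx:x\in X\}\in\mathcal C$; $\mathcal C[X,Y]$ is the set of basis relations in $X\times Y$; $\mathcal C[X]=\mathcal C[X,X]$ is a cell; $\mathcal C[X,Y]$ ($X\ne Y$) is uniform if it equals $\{X\times Y\}$. For distinct 4-point fibers, $\mathcal C[X,Y]$ is of type $2K_{2,2}$ if it consists of two basis relations $R$ and $(X\times Y)\setminus R$ with $R=\{x_1,x_2\}\times\{y_1,y_2\}\cup\{x_3,x_4\}\times\{y_3,y_4\}$ for suitable enumerations; it then determines in $Y$ the relation $\{y_1y_2,y_2y_1,y_3y_4,y_4y_3\}$. Interspaces $\mathcal C[X,Y],\mathcal C[Z,Y]$ of type $2K_{2,2}$ are directly connected at $Y$ if they determine the same relation in $Y$. $\mathcal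 C$ is irredundant if it is indecomposable (fibers cannot be split into two nonempty parts with all interspaces between the parts uniform), all fibers have size 4, and all non-uniform interspaces are of type $2K_{2,2}$. The fiber graph $\Gamma(\mathcal C)$ has the fibers as vertices, $X,Y$ adjacent iff $\mathcal C[X,Y]$ is non-uniform. For a non-uniform $\mathcal C[X,Y]$, $D(X,Y)$ consists of $X$, $Y$ and all fibers $Z$ such that $\mathcal C[Z,X]$ is non-uniform and directly connected with $\mathcal C[Y,X]$ at $X$; $\mathcal D(\mathcal C)$ is the family of all such sets. For a set $S$ of edges of $\Gamma(\mathcal C)$, $f_S$ is the permutation of $\mathcal C$ interchanging the two basis relations of $\mathcal C[X,Y]$ and those of $\mathcal C[Y,X]$ for each $\{X,Y\}\in S$ and fixing all other basis relations. For $C\in\mathcal D(\mathcal C)$ and $X\in C$, $f_{X,C}=f_{S}$ with $S=\{\{X,Y\}:Y\in C\setminus\{X\}\}$. A strict algebraic automorphism is a bijection $f:\mathcal C\to\mathcal C$ with $p^T_{RS}=p^{f(T)}_{f(R)f(S)}$ for all $R,S,T$ and $f(R)=R$ for every $R$ in every cell. -}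

module Defs where

open import Data.Nat using (ℕ; zero; suc; _+_)
open import Data.Fin using (Fin; zero; suc; _≟_)
open import Data.Fin.Properties using (any?)
open import Data.Bool using (Bool; true; false; if_then_else_)
open import Data.Product using (Σ; ∃; ∃-syntax; _×_; _,_; proj₁; proj₂)
open import Data.Product.Properties using () 
open import Data.Sum using (_⊎_; inj₁; inj₂)
open import Data.List using (List; []; _∷_)
open import Relation.Nullary using (¬_; Dec; yes; no; does; ¬?)
open import Relation.Nullary.Decidable using (_×-dec_; _⊎-dec_)
open import Relation.Unary using (Decidable)
open import Relation.Binary.PropositionalEquality using (_≡_; _≢_)
open import Function using (_∘_; id)
open import Function.Bundles using (_⇔_)
open import Function.Definitions using (Bijective)

count : ∀ {n} {P : Fin n → Set} → Decidable P → ℕ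
count {zero}  _  = 0
count {suc n} P? = (if does (P? zero) then 1 else 0) + count (λ i → P? (suc i))

-- The partition of V × V into
-- basis relations is encoded by a colouring  c : V → V → Fin m  together
-- with a representative pair for each colour (so every colour class, i.e.
-- every basis relation, is nonempty).

record CC : Set where
  field
    n      : ℕ
    m      : ℕ
    c      : Fin n → Fin n → Fin m
    rep    : Fin m → Fin n × Fin n
    rep-ok : ∀ i → c (proj₁ (rep i)) (proj₂ (rep i)) ≡ i
    loops  : ∀ u v w → c u u ≡ c v w → v ≡ w
    -- (B) the transpose of a basis relation is a basis relation
    transp : ∀ u v u' v' → c u v ≡ c u' v' → c v u ≡ c v' u'
    -- (C) intersection numbers are well defined
    regular : ∀ (R S : Fin m) (u v u' v' : Fin n) → c u v ≡ c u' v' →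
              count (λ w → (c u w ≟ R) ×-dec (c w v ≟ S))
                ≡ count (λ w → (c u' w ≟ R) ×-dec (c w v' ≟ S))

module _ (𝒞 : CC) where
  open CC 𝒞

  -- intersection number p^T_{RS}, evaluated at the representative of T
  p : Fin m → Fin m → Fin m → ℕ
  p T R S = count (λ w → (c (proj₁ (rep T)) w ≟ R) ×-dec (c w (proj₂ (rep T)) ≟ S))

  -- a colour X is a fiber (its basis relation consists of loops {xx : x ∈ X})
  IsFiber : Fin m → Set
  IsFiber X = ∀ u v → c u v ≡ X → u ≡ v

  _∈F_ : Fin n → Fin m → Set
  x ∈F X = c x x ≡ X

  InCell : Fin m → Set
  InCell j = Σ (Fin m) λ X → IsFiber X × (∀ u v → c u v ≡ j → (u ∈F X) × (v ∈F X))

  Uniform : Fin m → Fin m → Set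
  Uniform X Y = ∀ x y x' y' → x ∈F X → y ∈F Y → x' ∈F X → y' ∈F Y → c x y ≡ c x' y'

  -- X, Y distinct fibers with C[X,Y] non-uniform (= edge of the fiber graph)
  NonUniform : Fin m → Fin m → Set
  NonUniform X Y = IsFiber X × IsFiber Y × X ≢ Y × ¬ Uniform X Y

  blk : Fin 4 → Bool
  blk zero = true
  blk (suc zero) = true
  blk (suc (suc _)) = false

  -- C[X,Y] is of type 2K_{2,2}: there are enumerations ex, ey of X and Y
  -- such that C[X,Y] consists of exactly the two basis relations
  -- R = {ex a ey b : blk a = blk b} and its complement in X × Y.
  Type2K22 : Fin m → Fin m → Set
  Type2K22 X Y =
    Σ (Fin 4 → Fin n) λ ex → Σ (Fin 4 → Fin n) λ ey →
      (∀ a b → ex a ≡ ex b → a ≡ b) × (∀ a b → ey a ≡ ey b → a ≡ b) ×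
      (∀ x → x ∈F X ⇔ (∃[ a ] ex a ≡ x)) × (∀ y → y ∈F Y ⇔ (∃[ b ] ey b ≡ y)) ×
      (∀ a b a' b' → (c (ex a) (ey b) ≡ c (ex a') (ey b'))
                       ⇔ ((blk a ≡ blk b) ⇔ (blk a' ≡ blk b')))

  FiberSize : Fin m → ℕ
  FiberSize X = count (λ x → c x x ≟ X)

  Indecomposable : Set
  Indecomposable = ∀ (P : Fin m → Bool) →
    (∃[ X ] IsFiber X × P X ≡ true) → (∃[ Y ] IsFiber Y × P Y ≡ false) →
    ¬ (∀ X Y → IsFiber X → IsFiber Y → P X ≡ true → P Y ≡ false → Uniform X Y)

  Irredundant : Set
  Irredundant = Indecomposable × (∀ X → IsFiber X → FiberSize X ≡ 4)
                × (∀ X Y → NonUniform X Y → Type2K22 X Y)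

  -- relation determined in Y by a type-2K_{2,2} interspace C[X,Y]:
  -- pairs of distinct points of Y lying in the same block (equivalently,
  -- with the same colours to every point of X)
  DetRel : Fin m → Fin m → Fin n → Fin n → Set
  DetRel X Y y y' = y ∈F Y × y' ∈F Y × y ≢ y' × (∀ x → x ∈F X → c x y ≡ c x y')

  DirConn : Fin m → Fin m → Fin m → Set
  DirConn X Z Y = Type2K22 X Y × Type2K22 Z Y × (∀ y y' → DetRel X Y y y' ⇔ DetRel Z Y y y')

  InD : Fin m → Fin m → Fin m → Set
  InD X Y W = W ≡ X ⊎ W ≡ Y ⊎ (NonUniform W X × DirConn Y W X)

  src tgt : Fin m → Fin m
  src j = c (proj₁ (rep j)) (proj₁ (rep j))
  tgt j = c (proj₂ (rep j)) (proj₂ (rep j))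

  -- the other basis relation in the interspace C[src j, tgt j] (if any)
  other : Fin m → Fin m
  other j with any? (λ x → any? (λ y → (c x x ≟ src j) ×-dec ((c y y ≟ tgt j) ×-dec ¬? (c x y ≟ j))))
  ... | yes (x , y , _) = c x y
  ... | no _ = j

  -- f_S for a (decidable) set S of edges; the unordered edge {X,Y} is in S
  -- iff S X Y or S Y X.
  fS : (S : Fin m → Fin m → Set) → (∀ X Y → Dec (S X Y)) → Fin m → Fin m
  fS S S? j = if does (S? (src j) (tgt j) ⊎-dec S? (tgt j) (src j)) then other j else j

  StrictAlgAut : (Fin m → Fin m) → Set
  StrictAlgAut f = Bijective _≡_ _≡_ f
                 × (∀ T R S → p T R S ≡ p (f T) (f R) (f S))
                 × (∀ j → InCell j → f j ≡ j)

  CutCond : (S : Fin m → Fin m → Set) → (Fin m → Set) → Set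
  CutCond S C =
    (∀ A B → C A → C B → ¬ (S A B ⊎ S B A))
    ⊎ Σ (Fin m → Bool) λ side →
        (∃[ A ] C A × side A ≡ true) × (∃[ B ] C B × side B ≡ false) ×
        (∀ A B → C A → C B → A ≢ B → ((S A B ⊎ S B A) ⇔ (side A ≢ side B)))

  -- a generator f_{X,C} with C = D(Y,Z) ∈ 𝒟(𝒞) and X ∈ C
  record Gen : Set where
    field
      X Y Z : Fin m
      nonunif : NonUniform Y Z
      X∈C : InD Y Z X
      C? : ∀ W → Dec (InD Y Z W)

  genS : Gen → Fin m → Fin m → Set
  genS g A B = A ≡ Gen.X g × InD (Gen.Y g) (Gen.Z g) B × B ≢ Gen.X g

  genS? : (g : Gen) → ∀ A B → Dec (genS g A B)
  genS? g A B = (A ≟ Gen.X g) ×-dec (Gen.C? g B ×-dec ¬? (B ≟ Gen.X g))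

  fGen : Gen → Fin m → Fin m
  fGen g = fS (genS g) (genS? g)

  word : List Gen → Fin m → Fin m
  word []       = id
  word (g ∷ gs) = fGen g ∘ word gs

module Submission where

-- An interspace C[X,Y] of type 2K₂,₂ has exactly two colours, and once every point of X and
-- of Y is given the bit of its block, the colour of (x, y) is the xor of the two bits.  The map
-- f_S swaps the two colours on the edges in S.  It preserves p^T_{RS} as soon as, for every pair
-- (x, z) and every fiber Y, some permutation of Y carries the paths x – w – z onto paths whose
-- two colours are the f_S-images; for Y adjacent to both ends, such a permutation is a translation
-- of Y by the Klein four-group.  Translations shift the two block partitions of Y independently
-- when C[X,Y] and C[Z,Y] determine different relations on Y; when they determine the same one,
-- i.e. X, Y, Z lie in one class D, both shifts coincide and the edge parities around the triangle
-- must add up, which is exactly the cut condition on D.  Conversely, counting paths through such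
-- a triangle forces edge(A,B) = edge(A,X) xor edge(X,B) inside each class, so S cuts every class.
--
-- A strict algebraic automorphism fixes or swaps the two colours of each interspace, hence it is
-- f_S for an S satisfying the cut conditions.  Writing the cut of a class C as a side function s
-- with s = 0 at a canonical base point, f_S restricted to C is the product of the f_{X,C} with
-- s(X) = 1, and the product over all classes is f_S.

open import Defs
open import Algebra.Bundles using (CommutativeRing)
open import Data.Bool using (Bool; true; false; if_then_else_; not; _xor_)
import Data.Bool as Bool
open import Data.Bool.Properties
  using (xor-same; xor-comm; xor-assoc; xor-identityʳ; not-involutive; not-injective; not-¬; ¬-not; not-distribʳ-xor; not-distribˡ-xor; xor-inverseʳ;
         xor-∧-commutativeRing; ∨-comm)
open import Data.Fin using (Fin; zero; suc; _≟_; _≤_; punchIn; punchOut)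
open import Data.Fin.Properties using (any?; all?; ≤-antisym; _≤?_; punchInᵢ≢i; punchIn-injective; punchIn-punchOut)
open import Data.Fin.Permutation using (permutation)
open import Data.List using (List; []; _∷_; _++_; concat; tabulate)
open import Data.Nat as ℕ using (ℕ; _+_)
open import Data.Nat.Properties using (+-0-commutativeMonoid)
open import Data.Product using (Σ; ∃; ∃-syntax; _×_; _,_; proj₁; proj₂)
open import Data.Sum using (_⊎_; inj₁; inj₂; [_,_]′)
open import Function using (_∘_; id; case_of_)
open import Function.Bundles using (_⇔_; mk⇔; Equivalence)
open import Function.Properties.Equivalence using () renaming (refl to ⇔-refl; sym to ⇔-sym; trans to ⇔-trans)
open import Relation.Nullary using (¬_; Dec; yes; no; does; ¬?; contradiction)
open import Relation.Nullary.Decidable using (_×-dec_; _⊎-dec_; _→-dec_; map′; does-⇔; dec-true; dec-false; from-yes)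
open import Relation.Unary using (Decidable)
open import Relation.Binary.PropositionalEquality
import Algebra.Properties.CommutativeMonoid.Sum as MonoidSum
import Algebra.Properties.CommutativeSemigroup as CommutativeSemigroupProperties

open Equivalence using (to; from)

count≡sum : ∀ {n} {P : Fin n → Set} (P? : Decidable P) →
            count P? ≡ MonoidSum.sum +-0-commutativeMonoid (λ i → if does (P? i) then 1 else 0)
count≡sum {ℕ.zero}  _  = refl
count≡sum {ℕ.suc n} P? = cong (_ +_) (count≡sum (P? ∘ suc))

count-permute : ∀ {n} {P : Fin n → Set} (P? : Decidable P) (σ τ : Fin n → Fin n) →
                (∀ i → σ (τ i) ≡ i) → (∀ i → τ (σ i) ≡ i) → count P? ≡ count (P? ∘ σ)
count-permute P? σ τ στ τσ = begin
  count P?                                      ≡⟨ count≡sum P? ⟩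
  sum (λ i → if does (P? i) then 1 else 0)       ≡⟨ sum-permute _ (permutation σ τ στ τσ) ⟩
  sum (λ i → if does (P? (σ i)) then 1 else 0)   ≡⟨ count≡sum (P? ∘ σ) ⟨
  count (P? ∘ σ)                                ∎
  where open ≡-Reasoning
        open MonoidSum +-0-commutativeMonoid using (sum; sum-permute)

count-cong : ∀ {n} {P Q : Fin n → Set} (P? : Decidable P) (Q? : Decidable Q) →
             (∀ i → P i ⇔ Q i) → count P? ≡ count Q?
count-cong {ℕ.zero}  _  _  _   = refl
count-cong {ℕ.suc n} P? Q? P⇔Q =
  cong₂ (λ b k → (if b then 1 else 0) + k)
        (does-⇔ (P⇔Q zero) (P? zero) (Q? zero))
        (count-cong (P? ∘ suc) (Q? ∘ suc) (P⇔Q ∘ suc))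

count≢0⇒∃ : ∀ {n} {P : Fin n → Set} (P? : Decidable P) → count P? ≢ 0 → ∃ P
count≢0⇒∃ {ℕ.zero}  P? ≢0 = contradiction refl ≢0
count≢0⇒∃ {ℕ.suc n} P? ≢0 with P? zero
... | yes p = zero , p
... | no _  = let i , p = count≢0⇒∃ (P? ∘ suc) ≢0 in suc i , p

∃⇒count≢0 : ∀ {n} {P : Fin n → Set} (P? : Decidable P) → ∃ P → count P? ≢ 0
∃⇒count≢0 P? (zero , p) with P? zero
... | yes _ = λ ()
... | no ¬p = contradiction p ¬p
∃⇒count≢0 P? (suc i , p) with P? zero
... | yes _ = λ ()
... | no _  = ∃⇒count≢0 (P? ∘ suc) (i , p)

∃-resp-count : ∀ {n} {P Q : Fin n → Set} (P? : Decidable P) (Q? : Decidable Q) →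
               count P? ≡ count Q? → ∃ P → ∃ Q
∃-resp-count P? Q? eq ∃P = count≢0⇒∃ Q? (λ q≡0 → ∃⇒count≢0 P? ∃P (trans eq q≡0))

≡-⇔-cong : ∀ {A : Set} {a a' b b' : A} → a ≡ a' → b ≡ b' → (a ≡ b) ⇔ (a' ≡ b')
≡-⇔-cong refl refl = ⇔-refl

open CommutativeSemigroupProperties (CommutativeRing.+-commutativeSemigroup xor-∧-commutativeRing)
  using () renaming (interchange to xor-interchange; xy∙z≈xz∙y to xor-right-comm)

xor-cancelˡ : ∀ a {b c} → a xor b ≡ a xor c → b ≡ c
xor-cancelˡ false eq = eq
xor-cancelˡ true  eq = not-injective eq

xor-cancelʳ : ∀ a {b c} → b xor a ≡ c xor a → b ≡ c
xor-cancelʳ a {b} {c} eq = xor-cancelˡ a (trans (xor-comm a b) (trans eq (xor-comm c a)))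

xor-involutiveˡ : ∀ a b → a xor (a xor b) ≡ b
xor-involutiveˡ false b = refl
xor-involutiveˡ true  b = not-involutive b

≡⇔xor≡false : ∀ {p q} → (p ≡ q) ⇔ (p xor q ≡ false)
≡⇔xor≡false {p} = mk⇔ (λ p≡q → trans (cong (p xor_) (sym p≡q)) (xor-same p))
                        (λ eq → xor-cancelˡ p (trans (xor-same p) (sym eq)))

≡false⇔⇒≡ : ∀ {x y} → ((x ≡ false) ⇔ (y ≡ false)) → x ≡ y
≡false⇔⇒≡ {false} x⇔y = sym (to x⇔y refl)
≡false⇔⇒≡ {true}  {false} x⇔y = contradiction (from x⇔y refl) λ ()
≡false⇔⇒≡ {true}  {true}  _   = refl

≡⇔≡⇔xor≡ : ∀ {p q p' q'} → ((p ≡ q) ⇔ (p' ≡ q')) ⇔ (p xor q ≡ p' xor q')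
≡⇔≡⇔xor≡ = mk⇔
  (λ e → ≡false⇔⇒≡ (⇔-trans (⇔-sym ≡⇔xor≡false) (⇔-trans e ≡⇔xor≡false)))
  (λ eq → ⇔-trans ≡⇔xor≡false (⇔-trans (mk⇔ (trans (sym eq)) (trans eq)) (⇔-sym ≡⇔xor≡false)))

xor-true : ∀ a → a xor true ≡ not a
xor-true false = refl
xor-true true  = refl

≢⇔xor≡true : ∀ {p q} → (p ≢ q) ⇔ (p xor q ≡ true)
≢⇔xor≡true {p} {q} = mk⇔ (λ p≢q → trans (cong (p xor_) (¬-not (p≢q ∘ sym))) (xor-inverseʳ p))
                          (λ eq p≡q → not-¬ refl (trans (sym (to ≡⇔xor≡false p≡q)) eq))

≡true⇔⇒≡ : ∀ {x y} → ((x ≡ true) ⇔ (y ≡ true)) → x ≡ y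
≡true⇔⇒≡ {true} x⇔y = sym (to x⇔y refl)
≡true⇔⇒≡ {false} {false} _ = refl
≡true⇔⇒≡ {false} {true} x⇔y = contradiction (from x⇔y refl) λ ()

xor-telescope : ∀ a b c → (a xor b) xor (b xor c) ≡ a xor c
xor-telescope a b c = trans (xor-assoc a b (b xor c)) (cong (a xor_) (xor-involutiveˡ b c))

open MonoidSum (CommutativeRing.+-commutativeMonoid xor-∧-commutativeRing)
  using () renaming (sum to ⨁; sum-cong-≗ to ⨁-cong; sum-replicate-zero to ⨁-false; sum-remove to ⨁-remove)

⨁-zero : ∀ {k} (t : Fin k → Bool) → (∀ i → t i ≡ false) → ⨁ t ≡ false
⨁-zero {k} t t≡false = trans (⨁-cong t≡false) (⨁-false k)

⨁-single : ∀ {k} (t : Fin k → Bool) i₀ → (∀ i → i ≢ i₀ → t i ≡ false) → ⨁ t ≡ t i₀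
⨁-single {ℕ.suc k} t i₀ t≡false = begin
  ⨁ t                          ≡⟨ ⨁-remove {i = i₀} t ⟩
  t i₀ xor ⨁ (t ∘ punchIn i₀)  ≡⟨ cong (t i₀ xor_) (⨁-zero _ λ j → t≡false _ (punchInᵢ≢i i₀ j)) ⟩
  t i₀ xor false               ≡⟨ xor-identityʳ (t i₀) ⟩
  t i₀                         ∎
  where open ≡-Reasoning

⨁-pair : ∀ {k} (t : Fin k → Bool) {i₀ i₁} → i₀ ≢ i₁ → (∀ i → i ≢ i₀ → i ≢ i₁ → t i ≡ false) → ⨁ t ≡ t i₀ xor t i₁
⨁-pair {ℕ.suc k} t {i₀} {i₁} i₀≢i₁ t≡false = begin
  ⨁ t                          ≡⟨ ⨁-remove {i = i₀} t ⟩
  t i₀ xor ⨁ (t ∘ punchIn i₀)  ≡⟨ cong (t i₀ xor_) (⨁-single _ (punchOut i₀≢i₁) λ j j≢ →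
                                     t≡false _ (punchInᵢ≢i i₀ j)
                                       λ eq → j≢ (punchIn-injective i₀ _ _ (trans eq (sym (punchIn-punchOut i₀≢i₁))))) ⟩
  t i₀ xor t (punchIn i₀ (punchOut i₀≢i₁)) ≡⟨ cong (λ i → t i₀ xor t i) (punchIn-punchOut i₀≢i₁) ⟩
  t i₀ xor t i₁                ∎
  where open ≡-Reasoning

-- The Klein four-group on Fin 4

infixl 6 _⊕_

_⊕_ : Fin 4 → Fin 4 → Fin 4
zero                   ⊕ j                      = j
suc zero               ⊕ zero                   = suc zero
suc zero               ⊕ suc zero               = zero
suc zero               ⊕ suc (suc zero)         = suc (suc (suc zero))
suc zero               ⊕ suc (suc (suc zero))   = suc (suc zero)
suc (suc zero)         ⊕ zero                   = suc (suc zero)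
suc (suc zero)         ⊕ suc zero               = suc (suc (suc zero))
suc (suc zero)         ⊕ suc (suc zero)         = zero
suc (suc zero)         ⊕ suc (suc (suc zero))   = suc zero
suc (suc (suc zero))   ⊕ zero                   = suc (suc (suc zero))
suc (suc (suc zero))   ⊕ suc zero               = suc (suc zero)
suc (suc (suc zero))   ⊕ suc (suc zero)         = suc zero
suc (suc (suc zero))   ⊕ suc (suc (suc zero))   = zero

⊕-involutive : ∀ k i → k ⊕ (k ⊕ i) ≡ i
⊕-involutive = from-yes (all? λ k → all? λ i → k ⊕ (k ⊕ i) ≟ i)

blockShift : Bool → Fin 4
blockShift false = zero
blockShift true  = suc (suc zero)

blk-blockShift : ∀ 𝒞 s i → blk 𝒞 (blockShift s ⊕ i) ≡ blk 𝒞 i xor s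
blk-blockShift 𝒞 false i = sym (xor-identityʳ (blk 𝒞 i))
blk-blockShift 𝒞 true  i = trans (flip i) (sym (xor-true (blk 𝒞 i)))
  where
  flip : ∀ i → blk 𝒞 (suc (suc zero) ⊕ i) ≡ not (blk 𝒞 i)
  flip zero                 = refl
  flip (suc zero)           = refl
  flip (suc (suc zero))     = refl
  flip (suc (suc (suc zero))) = refl

module _ (𝒞 : CC) where

  private
    table : Fin 4 → Fin 4 → Fin 4 → Fin 4 → Fin 4 → Fin 4
    table p₀ _  _  _  zero                   = p₀
    table _  p₁ _  _  (suc zero)             = p₁
    table _  _  p₂ _  (suc (suc zero))       = p₂
    table _  _  _  p₃ (suc (suc (suc zero))) = p₃

    table-η : ∀ (π : Fin 4 → Fin 4) i → π i ≡ table (π zero) (π (suc zero)) (π (suc (suc zero))) (π (suc (suc (suc zero)))) i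
    table-η π zero                   = refl
    table-η π (suc zero)             = refl
    table-η π (suc (suc zero))       = refl
    table-η π (suc (suc (suc zero))) = refl

    bool? : ∀ {P : Bool → Set} → (∀ b → Dec (P b)) → Dec (∀ b → P b)
    bool? P? with P? false | P? true
    ... | yes pf | yes pt = yes λ { false → pf ; true → pt }
    ... | no ¬pf | _      = no λ ∀P → ¬pf (∀P false)
    ... | _      | no ¬pt = no λ ∀P → ¬pt (∀P true)

  BlocksShift : (Fin 4 → Fin 4) → Bool → Bool → Fin 4 → Set
  BlocksShift π a e k = ∀ i → (blk 𝒞 (k ⊕ i) ≡ blk 𝒞 i xor a) × (blk 𝒞 (π (k ⊕ i)) ≡ blk 𝒞 (π i) xor e)

  PreservesBlocks : (Fin 4 → Fin 4) → Set
  PreservesBlocks π = ∀ i j → blk 𝒞 i xor blk 𝒞 j ≡ blk 𝒞 (π i) xor blk 𝒞 (π j)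

  private
    Klein : (Fin 4 → Fin 4) → Bool → Bool → Set
    Klein π a e = (∀ i j → π i ≡ π j → i ≡ j) → ¬ PreservesBlocks π → Σ (Fin 4) (BlocksShift π a e)

    klein? : ∀ π a e → Dec (Klein π a e)
    klein? π a e =
      (all? λ i → all? λ j → (π i ≟ π j) →-dec (i ≟ j)) →-dec
      ¬? (all? λ i → all? λ j → blk 𝒞 i xor blk 𝒞 j Bool.≟ blk 𝒞 (π i) xor blk 𝒞 (π j)) →-dec
      any? λ k → all? λ i → (blk 𝒞 (k ⊕ i) Bool.≟ blk 𝒞 i xor a) ×-dec (blk 𝒞 (π (k ⊕ i)) Bool.≟ blk 𝒞 (π i) xor e)

    -- abstract, so that uses of klein-tables do not unfold the exhaustive check
    abstract
      klein-tables : ∀ p₀ p₁ p₂ p₃ a e → Klein (table p₀ p₁ p₂ p₃) a e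
      klein-tables = from-yes (all? λ p₀ → all? λ p₁ → all? λ p₂ → all? λ p₃ → bool? λ a → bool? λ e →
                                 klein? (table p₀ p₁ p₂ p₃) a e)

  -- The pairings of Fin 4 are the coset partitions of the order-2 subgroups of (Fin 4, ⊕),
  -- so translations shift two different pairings independently.
  klein : ∀ π a e → (∀ i j → π i ≡ π j → i ≡ j) → ¬ PreservesBlocks π → Σ (Fin 4) (BlocksShift π a e)
  klein π a e π-injective ¬pres with klein-tables _ _ _ _ a e
      (λ i j eq → π-injective i j (trans (table-η π i) (trans eq (sym (table-η π j)))))
      (λ pres → ¬pres λ i j → trans (pres i j) (cong₂ (λ u v → blk 𝒞 u xor blk 𝒞 v) (sym (table-η π i)) (sym (table-η π j))))
  ... | k , shift = k , λ i → proj₁ (shift i) ,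
          trans (cong (blk 𝒞) (table-η π (k ⊕ i)))
                (trans (proj₂ (shift i)) (cong (λ u → blk 𝒞 u xor e) (sym (table-η π i))))

module _ (𝒞 : CC) where
  open CC 𝒞

  Path : Fin n → Fin n → Fin m → Fin m → Set
  Path u v R S = ∃ λ w → c u w ≡ R × c w v ≡ S

  path? : ∀ u v R S → Decidable (λ w → c u w ≡ R × c w v ≡ S)
  path? u v R S w = (c u w ≟ R) ×-dec (c w v ≟ S)

  transfer-path : ∀ {u v u' v' R S} → c u v ≡ c u' v' → Path u v R S → Path u' v' R S
  transfer-path {u} {v} {u'} {v'} {R} {S} eq =
    ∃-resp-count (path? u v R S) (path? u' v' R S) (regular R S u v u' v' eq)

  source-fiber : ∀ {u v u' v'} → c u v ≡ c u' v' → c u u ≡ c u' u'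
  source-fiber {u} {v} {u'} eq with transfer-path eq (u , refl , refl)
  ... | w , u'w≡uu , _ = trans (sym u'w≡uu) (cong (c u') (sym (loops u u' w (sym u'w≡uu))))

  target-fiber : ∀ {u v u' v'} → c u v ≡ c u' v' → c v v ≡ c v' v'
  target-fiber eq = source-fiber (transp _ _ _ _ eq)

  loop-isFiber : ∀ u → IsFiber 𝒞 (c u u)
  loop-isFiber u v w eq = loops u v w (sym eq)

  src-colour : ∀ {u v j} → c u v ≡ j → src 𝒞 j ≡ c u u
  src-colour {j = j} eq = source-fiber (trans (rep-ok j) (sym eq))

  tgt-colour : ∀ {u v j} → c u v ≡ j → tgt 𝒞 j ≡ c v v
  tgt-colour {j = j} eq = target-fiber (trans (rep-ok j) (sym eq))

  point : Fin m → Fin n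
  point X = proj₁ (rep X)

  point-∈ : ∀ {X} → IsFiber 𝒞 X → _∈F_ 𝒞 (point X) X
  point-∈ {X} fib = subst (λ w → c (point X) w ≡ X) (sym (fib _ _ (rep-ok X))) (rep-ok X)

  IsFiber? : ∀ X → Dec (IsFiber 𝒞 X)
  IsFiber? X = all? λ u → all? λ v → (c u v ≟ X) →-dec (u ≟ v)

  Uniform? : ∀ X Y → Dec (Uniform 𝒞 X Y)
  Uniform? X Y = all? λ x → all? λ y → all? λ x' → all? λ y' →
    (c x x ≟ X) →-dec (c y y ≟ Y) →-dec (c x' x' ≟ X) →-dec (c y' y' ≟ Y) →-dec (c x y ≟ c x' y')

  NonUniform? : ∀ X Y → Dec (NonUniform 𝒞 X Y)
  NonUniform? X Y = IsFiber? X ×-dec IsFiber? Y ×-dec ¬? (X ≟ Y) ×-dec ¬? (Uniform? X Y)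

  Uniform-sym : ∀ {X Y} → Uniform 𝒞 X Y → Uniform 𝒞 Y X
  Uniform-sym u y x y' x' y∈ x∈ y'∈ x'∈ = transp _ _ _ _ (u x y x' y' x∈ y∈ x'∈ y'∈)

  NonUniform-sym : ∀ {X Y} → NonUniform 𝒞 X Y → NonUniform 𝒞 Y X
  NonUniform-sym (fibX , fibY , X≢Y , ¬u) = fibY , fibX , X≢Y ∘ sym , ¬u ∘ Uniform-sym

  NonUniform-irrefl : ∀ {X} → ¬ NonUniform 𝒞 X X
  NonUniform-irrefl (_ , _ , X≢X , _) = X≢X refl

  ¬NonUniform⇒Uniform : ∀ {X Y} → IsFiber 𝒞 X → IsFiber 𝒞 Y → X ≢ Y → ¬ NonUniform 𝒞 X Y → Uniform 𝒞 X Y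
  ¬NonUniform⇒Uniform {X} {Y} fibX fibY X≢Y ¬nu with Uniform? X Y
  ... | yes u  = u
  ... | no ¬u = contradiction (fibX , fibY , X≢Y , ¬u) ¬nu

  flipIf : Bool → Fin m → Fin m
  flipIf b j = if b then other 𝒞 j else j

  OtherWitness : Fin m → Fin n → Fin n → Set
  OtherWitness j x y = (c x x ≡ src 𝒞 j) × (c y y ≡ tgt 𝒞 j) × (c x y ≢ j)

  otherWitness? : ∀ j x y → Dec (OtherWitness j x y)
  otherWitness? j x y = (c x x ≟ src 𝒞 j) ×-dec ((c y y ≟ tgt 𝒞 j) ×-dec ¬? (c x y ≟ j))

  other-witness : ∀ {j x y} → OtherWitness j x y →
                  Σ (Fin n) λ x' → Σ (Fin n) λ y' → OtherWitness j x' y' × other 𝒞 j ≡ c x' y'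
  other-witness {j} {x} {y} w with any? (λ x → any? (λ y → otherWitness? j x y))
  ... | yes (x' , y' , w') = x' , y' , w' , refl
  ... | no ¬w = contradiction (x , y , w) ¬w

  other-src : ∀ j → src 𝒞 (other 𝒞 j) ≡ src 𝒞 j
  other-src j with any? (λ x → any? (λ y → otherWitness? j x y))
  ... | yes (_ , _ , x∈ , _) = trans (src-colour refl) x∈
  ... | no _ = refl

  other-tgt : ∀ j → tgt 𝒞 (other 𝒞 j) ≡ tgt 𝒞 j
  other-tgt j with any? (λ x → any? (λ y → otherWitness? j x y))
  ... | yes (_ , _ , _ , y∈ , _) = trans (tgt-colour refl) y∈
  ... | no _ = refl

  flipIf-src : ∀ b j → src 𝒞 (flipIf b j) ≡ src 𝒞 j
  flipIf-src false j = refl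
  flipIf-src true  j = other-src j

  flipIf-tgt : ∀ b j → tgt 𝒞 (flipIf b j) ≡ tgt 𝒞 j
  flipIf-tgt false j = refl
  flipIf-tgt true  j = other-tgt j

module _ (𝒞 : CC) where
  open CC 𝒞

  PreservesIntersectionNumbers : (Fin m → Fin m) → Set
  PreservesIntersectionNumbers f = ∀ T R S → p 𝒞 T R S ≡ p 𝒞 (f T) (f R) (f S)

  p-preserved : (f : Fin m → Fin m) → (∀ {a b} → f a ≡ f b → a ≡ b) → (∀ j → tgt 𝒞 (f j) ≡ tgt 𝒞 j) →
                ∀ T R S {x z x' z'} (σ : Fin n → Fin n) → (∀ w → σ (σ w) ≡ w) →
                (∀ w → c (σ w) (σ w) ≡ c w w) → c x z ≡ T → c x' z' ≡ f T →
                (∀ w → _∈F_ 𝒞 w (tgt 𝒞 R) → c x' (σ w) ≡ f (c x w) × c (σ w) z' ≡ f (c w z)) →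
                p 𝒞 T R S ≡ p 𝒞 (f T) (f R) (f S)
  p-preserved f f-injective f-tgt T R S {x} {z} {x'} {z'} σ σ-involutive σ-fiber xz≡ x'z'≡ image = begin
    p 𝒞 T R S                               ≡⟨ regular R S _ _ x z (trans (rep-ok T) (sym xz≡)) ⟩
    count (path? 𝒞 x z R S)                 ≡⟨ count-cong (path? 𝒞 x z R S) (path? 𝒞 x' z' (f R) (f S) ∘ σ) path⇔ ⟩
    count (path? 𝒞 x' z' (f R) (f S) ∘ σ)   ≡⟨ count-permute (path? 𝒞 x' z' (f R) (f S)) σ σ σ-involutive σ-involutive ⟨
    count (path? 𝒞 x' z' (f R) (f S))       ≡⟨ regular (f R) (f S) x' z' _ _ (trans x'z'≡ (sym (rep-ok (f T)))) ⟩
    p 𝒞 (f T) (f R) (f S)                   ∎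
    where
    open ≡-Reasoning
    path⇔ : ∀ w → (c x w ≡ R × c w z ≡ S) ⇔ (c x' (σ w) ≡ f R × c (σ w) z' ≡ f S)
    path⇔ w = mk⇔
      (λ (xw≡ , wz≡) → let x'σw≡ , σwz'≡ = image w (sym (tgt-colour 𝒞 xw≡)) in
                       trans x'σw≡ (cong f xw≡) , trans σwz'≡ (cong f wz≡))
      (λ (x'σw≡ , σwz'≡) →
        let w∈ = trans (sym (σ-fiber w)) (trans (sym (tgt-colour 𝒞 x'σw≡)) (f-tgt R))
            x'σw≡′ , σwz'≡′ = image w w∈ in
        f-injective (trans (sym x'σw≡′) x'σw≡) , f-injective (trans (sym σwz'≡′) σwz'≡))

  path-image : ∀ f → PreservesIntersectionNumbers f → ∀ {u v R S} → Path 𝒞 u v R S →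
               Path 𝒞 (proj₁ (rep (f (c u v)))) (proj₂ (rep (f (c u v)))) (f R) (f S)
  path-image f pres {u} {v} {R} {S} path =
    ∃-resp-count (path? 𝒞 _ _ R S) (path? 𝒞 _ _ (f R) (f S)) (pres (c u v) R S) (transfer-path 𝒞 (sym (rep-ok _)) path)

-- Coordinates in an interspace of type 2K₂,₂

module Coordinates (𝒞 : CC) {X Y : Fin (CC.m 𝒞)} (t : Type2K22 𝒞 X Y) where
  open CC 𝒞

  ex : Fin 4 → Fin n
  ex = proj₁ t

  ey : Fin 4 → Fin n
  ey = proj₁ (proj₂ t)

  ex-injective : ∀ a b → ex a ≡ ex b → a ≡ b
  ex-injective = proj₁ (proj₂ (proj₂ t))

  ey-injective : ∀ a b → ey a ≡ ey b → a ≡ b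
  ey-injective = proj₁ (proj₂ (proj₂ (proj₂ t)))

  ∈X⇔ : ∀ x → _∈F_ 𝒞 x X ⇔ (∃[ a ] ex a ≡ x)
  ∈X⇔ = proj₁ (proj₂ (proj₂ (proj₂ (proj₂ t))))

  ∈Y⇔ : ∀ y → _∈F_ 𝒞 y Y ⇔ (∃[ b ] ey b ≡ y)
  ∈Y⇔ = proj₁ (proj₂ (proj₂ (proj₂ (proj₂ (proj₂ t)))))

  colour≡⇔ : ∀ a b a' b' → (c (ex a) (ey b) ≡ c (ex a') (ey b'))
                            ⇔ ((blk 𝒞 a ≡ blk 𝒞 b) ⇔ (blk 𝒞 a' ≡ blk 𝒞 b'))
  colour≡⇔ = proj₂ (proj₂ (proj₂ (proj₂ (proj₂ (proj₂ t)))))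

  ex-∈ : ∀ a → _∈F_ 𝒞 (ex a) X
  ex-∈ a = from (∈X⇔ (ex a)) (a , refl)

  ey-∈ : ∀ b → _∈F_ 𝒞 (ey b) Y
  ey-∈ b = from (∈Y⇔ (ey b)) (b , refl)

  indexX : Fin n → Fin 4
  indexX x with any? (λ a → ex a ≟ x)
  ... | yes (a , _) = a
  ... | no _        = zero

  indexY : Fin n → Fin 4
  indexY y with any? (λ b → ey b ≟ y)
  ... | yes (b , _) = b
  ... | no _        = zero

  ex-indexX : ∀ {x} → _∈F_ 𝒞 x X → ex (indexX x) ≡ x
  ex-indexX {x} x∈ with any? (λ a → ex a ≟ x)
  ... | yes (_ , eq) = eq
  ... | no ∄a        = contradiction (to (∈X⇔ x) x∈) ∄a

  ey-indexY : ∀ {y} → _∈F_ 𝒞 y Y → ey (indexY y) ≡ y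
  ey-indexY {y} y∈ with any? (λ b → ey b ≟ y)
  ... | yes (_ , eq) = eq
  ... | no ∄b        = contradiction (to (∈Y⇔ y) y∈) ∄b

  indexX-ex : ∀ a → indexX (ex a) ≡ a
  indexX-ex a = ex-injective _ _ (ex-indexX (ex-∈ a))

  indexY-ey : ∀ b → indexY (ey b) ≡ b
  indexY-ey b = ey-injective _ _ (ey-indexY (ey-∈ b))

  bX bY : Fin n → Bool
  bX x = blk 𝒞 (indexX x)
  bY y = blk 𝒞 (indexY y)

  bit : Fin n → Fin n → Bool
  bit x y = bX x xor bY y

  colour≡⇔bit≡ : ∀ {x y x' y'} → _∈F_ 𝒞 x X → _∈F_ 𝒞 y Y → _∈F_ 𝒞 x' X → _∈F_ 𝒞 y' Y →
                 (c x y ≡ c x' y') ⇔ (bit x y ≡ bit x' y')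
  colour≡⇔bit≡ x∈ y∈ x'∈ y'∈ =
    ⇔-trans (≡-⇔-cong (cong₂ c (sym (ex-indexX x∈)) (sym (ey-indexY y∈)))
                      (cong₂ c (sym (ex-indexX x'∈)) (sym (ey-indexY y'∈))))
            (⇔-trans (colour≡⇔ _ _ _ _) ≡⇔≡⇔xor≡)

  blockPoint : Bool → Fin 4
  blockPoint true  = zero
  blockPoint false = suc (suc zero)

  ptX ptY : Bool → Fin n
  ptX b = ex (blockPoint b)
  ptY b = ey (blockPoint b)

  ptX-∈ : ∀ b → _∈F_ 𝒞 (ptX b) X
  ptX-∈ b = ex-∈ _

  ptY-∈ : ∀ b → _∈F_ 𝒞 (ptY b) Y
  ptY-∈ b = ey-∈ _

  bX-ptX : ∀ b → bX (ptX b) ≡ b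
  bX-ptX true  = cong (blk 𝒞) (indexX-ex _)
  bX-ptX false = cong (blk 𝒞) (indexX-ex _)

  bY-ptY : ∀ b → bY (ptY b) ≡ b
  bY-ptY true  = cong (blk 𝒞) (indexY-ey _)
  bY-ptY false = cong (blk 𝒞) (indexY-ey _)

  columns≡⇔bY≡ : ∀ {y y'} → _∈F_ 𝒞 y Y → _∈F_ 𝒞 y' Y →
                  (∀ x → _∈F_ 𝒞 x X → c x y ≡ c x y') ⇔ (bY y ≡ bY y')
  columns≡⇔bY≡ y∈ y'∈ = mk⇔
    (λ cols → xor-cancelˡ (bX (ptX true)) (to (colour≡⇔bit≡ (ptX-∈ true) y∈ (ptX-∈ true) y'∈) (cols _ (ptX-∈ true))))
    (λ bY≡ x x∈ → from (colour≡⇔bit≡ x∈ y∈ x∈ y'∈) (cong (bX x xor_) bY≡))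

  rows≡⇔bX≡ : ∀ {x x'} → _∈F_ 𝒞 x X → _∈F_ 𝒞 x' X →
               (∀ y → _∈F_ 𝒞 y Y → c x y ≡ c x' y) ⇔ (bX x ≡ bX x')
  rows≡⇔bX≡ x∈ x'∈ = mk⇔
    (λ rows → xor-cancelʳ (bY (ptY true)) (to (colour≡⇔bit≡ x∈ (ptY-∈ true) x'∈ (ptY-∈ true)) (rows _ (ptY-∈ true))))
    (λ bX≡ y y∈ → from (colour≡⇔bit≡ x∈ y∈ x'∈ y∈) (cong (_xor bY y) bX≡))

  flipX flipY : Fin n → Fin n
  flipX x = ptX (not (bX x))
  flipY y = ptY (not (bY y))

  bit-flipX : ∀ x y → bit (flipX x) y ≡ not (bit x y)
  bit-flipX x y = trans (cong (_xor bY y) (bX-ptX _)) (sym (not-distribˡ-xor (bX x) (bY y)))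

  bit-flipY : ∀ x y → bit x (flipY y) ≡ not (bit x y)
  bit-flipY x y = trans (cong (bX x xor_) (bY-ptY _)) (sym (not-distribʳ-xor (bX x) (bY y)))

  ≡other⇔bit≡not : ∀ {x y x' y'} → _∈F_ 𝒞 x X → _∈F_ 𝒞 y Y → _∈F_ 𝒞 x' X → _∈F_ 𝒞 y' Y →
                   (c x' y' ≡ other 𝒞 (c x y)) ⇔ (bit x' y' ≡ not (bit x y))
  ≡other⇔bit≡not {x} {y} x∈ y∈ x'∈ y'∈ =
    ⇔-trans (≡-⇔-cong refl other≡)
            (⇔-trans (colour≡⇔bit≡ x'∈ y'∈ x''∈ y''∈)
                     (≡-⇔-cong refl (¬-not (colour≢ ∘ from (colour≡⇔bit≡ x''∈ y''∈ x∈ y∈)))))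
    where
    witness : OtherWitness 𝒞 (c x y) x (flipY y)
    witness = sym (src-colour 𝒞 refl) , trans (ptY-∈ _) (trans (sym y∈) (sym (tgt-colour 𝒞 refl))) ,
              λ eq → not-¬ refl (sym (trans (sym (bit-flipY x y)) (to (colour≡⇔bit≡ x∈ (ptY-∈ _) x∈ y∈) eq)))
    other-pair = other-witness 𝒞 witness
    x'' = proj₁ other-pair
    y'' = proj₁ (proj₂ other-pair)
    other≡ : other 𝒞 (c x y) ≡ c x'' y''
    other≡ = proj₂ (proj₂ (proj₂ other-pair))
    colour≢ : c x'' y'' ≢ c x y
    colour≢ = proj₂ (proj₂ (proj₁ (proj₂ (proj₂ other-pair))))
    x''∈ : _∈F_ 𝒞 x'' X
    x''∈ = trans (proj₁ (proj₁ (proj₂ (proj₂ other-pair)))) (trans (src-colour 𝒞 refl) x∈)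
    y''∈ : _∈F_ 𝒞 y'' Y
    y''∈ = trans (proj₁ (proj₂ (proj₁ (proj₂ (proj₂ other-pair))))) (trans (tgt-colour 𝒞 refl) y∈)

  colour-shift : ∀ {x y x' y'} → _∈F_ 𝒞 x X → _∈F_ 𝒞 y Y → _∈F_ 𝒞 x' X → _∈F_ 𝒞 y' Y →
                 ∀ e → (c x' y' ≡ flipIf 𝒞 e (c x y)) ⇔ (bit x' y' ≡ bit x y xor e)
  colour-shift x∈ y∈ x'∈ y'∈ false =
    ⇔-trans (colour≡⇔bit≡ x'∈ y'∈ x∈ y∈) (≡-⇔-cong refl (sym (xor-identityʳ _)))
  colour-shift x∈ y∈ x'∈ y'∈ true =
    ⇔-trans (≡other⇔bit≡not x∈ y∈ x'∈ y'∈) (≡-⇔-cong refl (sym (xor-true _)))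

  other≢ : ∀ {x y} → _∈F_ 𝒞 x X → _∈F_ 𝒞 y Y → other 𝒞 (c x y) ≢ c x y
  other≢ x∈ y∈ eq = not-¬ refl (to (≡other⇔bit≡not x∈ y∈ x∈ y∈) (sym eq))

  ≢⇒≡other : ∀ {x y x' y'} → _∈F_ 𝒞 x X → _∈F_ 𝒞 y Y → _∈F_ 𝒞 x' X → _∈F_ 𝒞 y' Y →
             c x' y' ≢ c x y → c x' y' ≡ other 𝒞 (c x y)
  ≢⇒≡other x∈ y∈ x'∈ y'∈ colour≢ =
    from (≡other⇔bit≡not x∈ y∈ x'∈ y'∈) (¬-not (colour≢ ∘ from (colour≡⇔bit≡ x'∈ y'∈ x∈ y∈)))

  other-involutive : ∀ {x y} → _∈F_ 𝒞 x X → _∈F_ 𝒞 y Y → other 𝒞 (other 𝒞 (c x y)) ≡ c x y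
  other-involutive {x} {y} x∈ y∈ = begin
    other 𝒞 (other 𝒞 (c x y))    ≡⟨ cong (other 𝒞) other≡ ⟨
    other 𝒞 (c x (flipY y))       ≡⟨ from (≡other⇔bit≡not x∈ (ptY-∈ _) x∈ y∈)
                                            (trans (sym (not-involutive _)) (cong not (sym (bit-flipY x y)))) ⟨
    c x y                         ∎
    where
    open ≡-Reasoning
    other≡ : c x (flipY y) ≡ other 𝒞 (c x y)
    other≡ = from (≡other⇔bit≡not x∈ y∈ x∈ (ptY-∈ _)) (bit-flipY x y)

  translateY : Fin 4 → Fin n → Fin n
  translateY k w with c w w ≟ Y
  ... | yes _ = ey (k ⊕ indexY w)
  ... | no _  = w

  translateY-∈ : ∀ k {w} → _∈F_ 𝒞 w Y → translateY k w ≡ ey (k ⊕ indexY w)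
  translateY-∈ k {w} w∈ with c w w ≟ Y
  ... | yes _  = refl
  ... | no w∉ = contradiction w∈ w∉

  translateY-fiber : ∀ k w → c (translateY k w) (translateY k w) ≡ c w w
  translateY-fiber k w with c w w ≟ Y
  ... | yes w∈ = trans (ey-∈ _) (sym w∈)
  ... | no _   = refl

  translateY-involutive : ∀ k w → translateY k (translateY k w) ≡ w
  translateY-involutive k w with c w w ≟ Y
  ... | no w∉ = translateY-no w∉
    where
    translateY-no : c w w ≢ Y → translateY k w ≡ w
    translateY-no w∉ with c w w ≟ Y
    ... | yes w∈ = contradiction w∈ w∉
    ... | no _   = refl
  ... | yes w∈ = begin
    translateY k (ey (k ⊕ indexY w))   ≡⟨ translateY-∈ k (ey-∈ _) ⟩
    ey (k ⊕ indexY (ey (k ⊕ indexY w))) ≡⟨ cong (λ i → ey (k ⊕ i)) (indexY-ey _) ⟩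
    ey (k ⊕ (k ⊕ indexY w))             ≡⟨ cong ey (⊕-involutive k _) ⟩
    ey (indexY w)                       ≡⟨ ey-indexY w∈ ⟩
    w                                   ∎
    where open ≡-Reasoning

  indexY-translateY : ∀ k {w} → _∈F_ 𝒞 w Y → indexY (translateY k w) ≡ k ⊕ indexY w
  indexY-translateY k w∈ = trans (cong indexY (translateY-∈ k w∈)) (indexY-ey _)

  shiftY : Bool → Fin n → Fin n
  shiftY s = translateY (blockShift s)

  bY-shiftY : ∀ s {w} → _∈F_ 𝒞 w Y → bY (shiftY s w) ≡ bY w xor s
  bY-shiftY s w∈ = trans (cong (blk 𝒞) (indexY-translateY (blockShift s) w∈)) (blk-blockShift 𝒞 s _)

  colour-shift-bits : ∀ {a a' w w'} → _∈F_ 𝒞 a X → _∈F_ 𝒞 a' X → _∈F_ 𝒞 w Y → _∈F_ 𝒞 w' Y → ∀ d s →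
                      bX a' ≡ bX a xor d → bY w' ≡ bY w xor s → c a' w' ≡ flipIf 𝒞 (d xor s) (c a w)
  colour-shift-bits {a} {w = w} a∈ a'∈ w∈ w'∈ d s bX≡ bY≡ =
    from (colour-shift a∈ w∈ a'∈ w'∈ (d xor s))
         (trans (cong₂ _xor_ bX≡ bY≡) (xor-interchange (bX a) d (bY w) s))

  shiftX : Bool → Fin n → Fin n
  shiftX false x = x
  shiftX true  x = flipX x

  shiftX-∈ : ∀ d {x} → _∈F_ 𝒞 x X → _∈F_ 𝒞 (shiftX d x) X
  shiftX-∈ false x∈ = x∈
  shiftX-∈ true  _  = ptX-∈ _

  bX-shiftX : ∀ d x → bX (shiftX d x) ≡ bX x xor d
  bX-shiftX false x = sym (xor-identityʳ (bX x))
  bX-shiftX true  x = trans (bX-ptX _) (sym (xor-true (bX x)))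

-- Directly connected interspaces and the classes D(X,Y)

module _ (𝒞 : CC) where
  open CC 𝒞

  SameColumns : Fin m → Fin n → Fin n → Set
  SameColumns A w w' = ∀ a → _∈F_ 𝒞 a A → c a w ≡ c a w'

  SameColumns? : ∀ A w w' → Dec (SameColumns A w w')
  SameColumns? A w w' = all? λ a → (c a a ≟ A) →-dec (c a w ≟ c a w')

  SameColumns⇔SameRows : ∀ {A w w'} → SameColumns A w w' ⇔ (∀ a → _∈F_ 𝒞 a A → c w a ≡ c w' a)
  SameColumns⇔SameRows = mk⇔ (λ cols a a∈ → transp _ _ _ _ (cols a a∈)) (λ rows a a∈ → transp _ _ _ _ (rows a a∈))

  Connected : Fin m → Fin m → Fin m → Set
  Connected A B W = ∀ w w' → _∈F_ 𝒞 w W → _∈F_ 𝒞 w' W → SameColumns A w w' ⇔ SameColumns B w w'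

  Connected? : ∀ A B W → Dec (Connected A B W)
  Connected? A B W = all? λ w → all? λ w' → (c w w ≟ W) →-dec (c w' w' ≟ W) →-dec
    map′ (λ (f , g) → mk⇔ f g) (λ e → to e , from e)
      ((SameColumns? A w w' →-dec SameColumns? B w w') ×-dec (SameColumns? B w w' →-dec SameColumns? A w w'))

  Connected-refl : ∀ {A W} → Connected A A W
  Connected-refl _ _ _ _ = ⇔-refl

  Connected-sym : ∀ {A B W} → Connected A B W → Connected B A W
  Connected-sym conn w w' w∈ w'∈ = ⇔-sym (conn w w' w∈ w'∈)

  Connected-trans : ∀ {A B C W} → Connected A B W → Connected B C W → Connected A C W
  Connected-trans conn conn' w w' w∈ w'∈ = ⇔-trans (conn w w' w∈ w'∈) (conn' w w' w∈ w'∈)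

  Class : Fin m → Fin m → Fin m → Set
  Class X Y W = W ≡ X ⊎ (NonUniform 𝒞 W X × Connected Y W X)

  Class? : ∀ X Y W → Dec (Class X Y W)
  Class? X Y W = (W ≟ X) ⊎-dec (NonUniform? 𝒞 W X ×-dec Connected? Y W X)

  DetRel⇔⇒Connected : ∀ {A B W} → (∀ y y' → DetRel 𝒞 A W y y' ⇔ DetRel 𝒞 B W y y') → Connected A B W
  DetRel⇔⇒Connected det w w' w∈ w'∈ with w ≟ w'
  ... | yes refl = mk⇔ (λ _ _ _ → refl) (λ _ _ _ → refl)
  ... | no w≢w' = mk⇔ (λ cols → proj₂ (proj₂ (proj₂ (to (det w w') (w∈ , w'∈ , w≢w' , cols)))))
                      (λ cols → proj₂ (proj₂ (proj₂ (from (det w w') (w∈ , w'∈ , w≢w' , cols)))))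

  Connected⇒DetRel⇔ : ∀ {A B W} → Connected A B W → ∀ y y' → DetRel 𝒞 A W y y' ⇔ DetRel 𝒞 B W y y'
  Connected⇒DetRel⇔ conn y y' =
    mk⇔ (λ (y∈ , y'∈ , y≢y' , cols) → y∈ , y'∈ , y≢y' , to (conn y y' y∈ y'∈) cols)
        (λ (y∈ , y'∈ , y≢y' , cols) → y∈ , y'∈ , y≢y' , from (conn y y' y∈ y'∈) cols)

module _ (𝒞 : CC) (irr : Irredundant 𝒞) where
  open CC 𝒞

  type2K22 : ∀ {X Y} → NonUniform 𝒞 X Y → Type2K22 𝒞 X Y
  type2K22 {X} {Y} = proj₂ (proj₂ irr) X Y

  module _ {X Y} (nu : NonUniform 𝒞 X Y) where
    open Coordinates 𝒞 (type2K22 nu)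

    two-colours : ∀ {x₀ y₀ x₁ y₁ x₂ y₂} →
                  _∈F_ 𝒞 x₀ X → _∈F_ 𝒞 y₀ Y → _∈F_ 𝒞 x₁ X → _∈F_ 𝒞 y₁ Y → _∈F_ 𝒞 x₂ X → _∈F_ 𝒞 y₂ Y →
                  c x₁ y₁ ≢ c x₀ y₀ → c x₂ y₂ ≢ c x₀ y₀ → c x₁ y₁ ≡ c x₂ y₂
    two-colours x₀∈ y₀∈ x₁∈ y₁∈ x₂∈ y₂∈ ≢₁ ≢₂ =
      trans (≢⇒≡other x₀∈ y₀∈ x₁∈ y₁∈ ≢₁) (sym (≢⇒≡other x₀∈ y₀∈ x₂∈ y₂∈ ≢₂))

    flipIf-transpose : ∀ {a a' w w'} → _∈F_ 𝒞 a X → _∈F_ 𝒞 a' X → _∈F_ 𝒞 w Y → _∈F_ 𝒞 w' Y → ∀ e →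
                       c a' w' ≡ flipIf 𝒞 e (c a w) → c w' a' ≡ flipIf 𝒞 e (c w a)
    flipIf-transpose _ _ _ _ false eq = transp _ _ _ _ eq
    flipIf-transpose a∈ a'∈ w∈ w'∈ true eq =
      Coordinates.≢⇒≡other 𝒞 (type2K22 (NonUniform-sym 𝒞 nu)) w∈ a∈ w'∈ a'∈
        (λ eq' → other≢ a∈ w∈ (trans (sym eq) (transp _ _ _ _ eq')))

  nonUniform⇒other-involutive : ∀ j → NonUniform 𝒞 (src 𝒞 j) (tgt 𝒞 j) → other 𝒞 (other 𝒞 j) ≡ j
  nonUniform⇒other-involutive j nu =
    subst (λ k → other 𝒞 (other 𝒞 k) ≡ k) (rep-ok j) (Coordinates.other-involutive 𝒞 (type2K22 nu) refl refl)

  flipIf-flipIf : ∀ a b j → (a ≡ true → NonUniform 𝒞 (src 𝒞 j) (tgt 𝒞 j)) →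
                  flipIf 𝒞 a (flipIf 𝒞 b j) ≡ flipIf 𝒞 (a xor b) j
  flipIf-flipIf false b     j _  = refl
  flipIf-flipIf true  false j _  = refl
  flipIf-flipIf true  true  j nu = nonUniform⇒other-involutive j (nu refl)

  module Connection {X Y Z} (nuXY : NonUniform 𝒞 X Y) (nuZY : NonUniform 𝒞 Z Y) (X≢Z : X ≢ Z)
                    (conn : Connected 𝒞 X Z Y) where
    module K₁ = Coordinates 𝒞 (type2K22 nuXY)
    module K₂ = Coordinates 𝒞 (type2K22 nuZY)
    open ≡-Reasoning

    bY-agree : ∀ {w w'} → _∈F_ 𝒞 w Y → _∈F_ 𝒞 w' Y → K₁.bY w xor K₁.bY w' ≡ K₂.bY w xor K₂.bY w'
    bY-agree w∈ w'∈ =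
      to ≡⇔≡⇔xor≡ (⇔-trans (⇔-sym (K₁.columns≡⇔bY≡ w∈ w'∈)) (⇔-trans (conn _ _ w∈ w'∈) (K₂.columns≡⇔bY≡ w∈ w'∈)))

    w₀ : Fin n
    w₀ = K₁.ptY true

    δ : Bool
    δ = K₁.bY w₀ xor K₂.bY w₀

    bY₂≡bY₁xorδ : ∀ {w} → _∈F_ 𝒞 w Y → K₂.bY w ≡ K₁.bY w xor δ
    bY₂≡bY₁xorδ {w} w∈ = begin
      K₂.bY w                                        ≡⟨ xor-involutiveˡ (K₂.bY w₀) (K₂.bY w) ⟨
      K₂.bY w₀ xor (K₂.bY w₀ xor K₂.bY w)            ≡⟨ cong (K₂.bY w₀ xor_) (xor-comm (K₂.bY w₀) (K₂.bY w)) ⟩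
      K₂.bY w₀ xor (K₂.bY w xor K₂.bY w₀)            ≡⟨ cong (K₂.bY w₀ xor_) (bY-agree w∈ (K₁.ptY-∈ true)) ⟨
      K₂.bY w₀ xor (K₁.bY w xor K₁.bY w₀)            ≡⟨ xor-comm (K₂.bY w₀) _ ⟩
      (K₁.bY w xor K₁.bY w₀) xor K₂.bY w₀            ≡⟨ xor-assoc (K₁.bY w) _ _ ⟩
      K₁.bY w xor δ                                  ∎

    -- The block partitions of Y seen from X and from Z agree up to the constant δ, which makes
    -- the colours of C[X,Z] a function of β.
    β : Fin n → Fin n → Bool
    β x z = K₁.bX x xor K₂.bX z

    bits≡β : ∀ x z {w} → _∈F_ 𝒞 w Y → K₁.bit x w xor K₂.bit z w ≡ β x z xor δ
    bits≡β x z {w} w∈ = begin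
      (K₁.bX x xor K₁.bY w) xor (K₂.bX z xor K₂.bY w)    ≡⟨ xor-interchange (K₁.bX x) _ _ _ ⟩
      β x z xor (K₁.bY w xor K₂.bY w)                    ≡⟨ cong (λ b → β x z xor (K₁.bY w xor b)) (bY₂≡bY₁xorδ w∈) ⟩
      β x z xor (K₁.bY w xor (K₁.bY w xor δ))            ≡⟨ cong (β x z xor_) (xor-involutiveˡ (K₁.bY w) δ) ⟩
      β x z xor δ                                        ∎

    colour≡⇒β≡ : ∀ {x z x' z'} → _∈F_ 𝒞 x X → _∈F_ 𝒞 z Z → _∈F_ 𝒞 x' X → _∈F_ 𝒞 z' Z →
                 c x z ≡ c x' z' → β x z ≡ β x' z'
    colour≡⇒β≡ {x} {z} {x'} {z'} x∈ z∈ x'∈ z'∈ eq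
      with transfer-path 𝒞 eq (w₀ , refl , refl)
    ... | w , x'w≡ , wz'≡ = xor-cancelʳ δ (begin
      β x z xor δ                               ≡⟨ bits≡β x z w₀∈ ⟨
      K₁.bit x w₀ xor K₂.bit z w₀               ≡⟨ cong₂ _xor_ bit₁≡ bit₂≡ ⟩
      K₁.bit x' w xor K₂.bit z' w               ≡⟨ bits≡β x' z' w∈ ⟩
      β x' z' xor δ                             ∎)
      where
      w₀∈ = K₁.ptY-∈ true
      w∈ : _∈F_ 𝒞 w Y
      w∈ = trans (target-fiber 𝒞 x'w≡) w₀∈
      bit₁≡ = to (K₁.colour≡⇔bit≡ x∈ w₀∈ x'∈ w∈) (sym x'w≡)
      bit₂≡ = to (K₂.colour≡⇔bit≡ z∈ w₀∈ z'∈ w∈) (transp _ _ _ _ (sym wz'≡))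

    nuXZ : NonUniform 𝒞 X Z
    nuXZ = proj₁ nuXY , proj₁ nuZY , X≢Z , λ unif →
      not-¬ refl (begin
        true                     ≡⟨ K₂.bX-ptX true ⟨
        K₂.bX (K₂.ptX true)      ≡⟨ xor-cancelˡ (K₁.bX x) (colour≡⇒β≡ x∈ (K₂.ptX-∈ true) x∈ (K₂.ptX-∈ false)
                                      (unif _ _ _ _ x∈ (K₂.ptX-∈ true) x∈ (K₂.ptX-∈ false))) ⟩
        K₂.bX (K₂.ptX false)     ≡⟨ K₂.bX-ptX false ⟩
        false                    ∎)
      where
      x = K₁.ptX true
      x∈ = K₁.ptX-∈ true

    β≡⇒colour≡ : ∀ {x z x' z'} → _∈F_ 𝒞 x X → _∈F_ 𝒞 z Z → _∈F_ 𝒞 x' X → _∈F_ 𝒞 z' Z →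
                 β x z ≡ β x' z' → c x z ≡ c x' z'
    β≡⇒colour≡ {x} {z} {x'} {z'} x∈ z∈ x'∈ z'∈ β≡ =
      two-colours nuXZ x'∈ z''∈ x∈ z∈ x'∈ z'∈
        (λ eq → not-¬ refl (trans (trans (sym β≡) (colour≡⇒β≡ x∈ z∈ x'∈ z''∈ eq)) β-flip))
        (λ eq → not-¬ refl (trans (colour≡⇒β≡ x'∈ z'∈ x'∈ z''∈ eq) β-flip))
      where
      z'' = K₂.ptX (not (K₂.bX z'))
      z''∈ = K₂.ptX-∈ (not (K₂.bX z'))
      β-flip : β x' z'' ≡ not (β x' z')
      β-flip = trans (cong (K₁.bX x' xor_) (K₂.bX-ptX _)) (sym (not-distribʳ-xor (K₁.bX x') (K₂.bX z')))

    colour≡⇔β≡ : ∀ {x z x' z'} → _∈F_ 𝒞 x X → _∈F_ 𝒞 z Z → _∈F_ 𝒞 x' X → _∈F_ 𝒞 z' Z →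
                 (c x z ≡ c x' z') ⇔ (β x z ≡ β x' z')
    colour≡⇔β≡ x∈ z∈ x'∈ z'∈ = mk⇔ (colour≡⇒β≡ x∈ z∈ x'∈ z'∈) (β≡⇒colour≡ x∈ z∈ x'∈ z'∈)

    colour-shift-β : ∀ {x z x' z'} → _∈F_ 𝒞 x X → _∈F_ 𝒞 z Z → _∈F_ 𝒞 x' X → _∈F_ 𝒞 z' Z →
                     ∀ e → (c x' z' ≡ flipIf 𝒞 e (c x z)) ⇔ (β x' z' ≡ β x z xor e)
    colour-shift-β x∈ z∈ x'∈ z'∈ false =
      ⇔-trans (colour≡⇔β≡ x'∈ z'∈ x∈ z∈) (≡-⇔-cong refl (sym (xor-identityʳ _)))
    colour-shift-β {x} {z} {x'} {z'} x∈ z∈ x'∈ z'∈ true = mk⇔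
      (λ eq → trans (¬-not λ β≡ → K₃.other≢ x∈ z∈ (trans (sym eq) (β≡⇒colour≡ x'∈ z'∈ x∈ z∈ β≡)))
                    (sym (xor-true _)))
      (λ β≡ → K₃.≢⇒≡other x∈ z∈ x'∈ z'∈ λ eq →
                not-¬ refl (trans (sym (colour≡⇒β≡ x'∈ z'∈ x∈ z∈ eq)) (trans β≡ (xor-true _))))
      where module K₃ = Coordinates 𝒞 (type2K22 nuXZ)

    connected-at-X : Connected 𝒞 Y Z X
    connected-at-X x x' x∈ x'∈ =
      ⇔-trans (SameColumns⇔SameRows 𝒞) (⇔-trans (K₁.rows≡⇔bX≡ x∈ x'∈) (mk⇔ ⇒cols cols⇒))
      where
      z₀∈ = K₂.ptX-∈ true
      ⇒cols : K₁.bX x ≡ K₁.bX x' → SameColumns 𝒞 Z x x'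
      ⇒cols bX≡ z z∈ = transp _ _ _ _ (β≡⇒colour≡ x∈ z∈ x'∈ z∈ (cong (_xor K₂.bX z) bX≡))
      cols⇒ : SameColumns 𝒞 Z x x' → K₁.bX x ≡ K₁.bX x'
      cols⇒ cols = xor-cancelʳ (K₂.bX (K₂.ptX true))
                     (colour≡⇒β≡ x∈ z₀∈ x'∈ z₀∈ (transp _ _ _ _ (cols _ z₀∈)))

  independent-shifts : ∀ {X Y Z} (nuXY : NonUniform 𝒞 X Y) (nuZY : NonUniform 𝒞 Z Y) → ¬ Connected 𝒞 X Z Y →
    let module K₁ = Coordinates 𝒞 (type2K22 nuXY)
        module K₂ = Coordinates 𝒞 (type2K22 nuZY) in
    ∀ a e → Σ (Fin 4) λ k → ∀ {w} → _∈F_ 𝒞 w Y →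
      K₁.bY (K₁.translateY k w) ≡ K₁.bY w xor a × K₂.bY (K₁.translateY k w) ≡ K₂.bY w xor e
  independent-shifts {Y = Y} nuXY nuZY ¬conn a e =
    k , λ w∈ → trans (cong (blk 𝒞) (K₁.indexY-translateY k w∈)) (proj₁ (shift _)) ,
               trans (cong (λ v → blk 𝒞 (K₂.indexY v)) (K₁.translateY-∈ k w∈))
                     (trans (proj₂ (shift _)) (cong (_xor e) (sym (bY₂≡ w∈))))
    where
    module K₁ = Coordinates 𝒞 (type2K22 nuXY)
    module K₂ = Coordinates 𝒞 (type2K22 nuZY)
    π : Fin 4 → Fin 4
    π i = K₂.indexY (K₁.ey i)
    π-injective : ∀ i j → π i ≡ π j → i ≡ j
    π-injective i j eq =
      K₁.ey-injective i j (trans (sym (K₂.ey-indexY (K₁.ey-∈ i))) (trans (cong K₂.ey eq) (K₂.ey-indexY (K₁.ey-∈ j))))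
    bY₂≡ : ∀ {w} → _∈F_ 𝒞 w Y → K₂.bY w ≡ blk 𝒞 (π (K₁.indexY w))
    bY₂≡ w∈ = cong (λ v → blk 𝒞 (K₂.indexY v)) (sym (K₁.ey-indexY w∈))
    ¬preserves : ¬ PreservesBlocks 𝒞 π
    ¬preserves pres = ¬conn λ w w' w∈ w'∈ →
      ⇔-trans (K₁.columns≡⇔bY≡ w∈ w'∈)
        (⇔-trans (from ≡⇔≡⇔xor≡ (trans (pres _ _) (sym (cong₂ _xor_ (bY₂≡ w∈) (bY₂≡ w'∈)))))
                 (⇔-sym (K₂.columns≡⇔bY≡ w∈ w'∈)))
    k = proj₁ (klein 𝒞 π a e π-injective ¬preserves)
    shift = proj₂ (klein 𝒞 π a e π-injective ¬preserves)

  InD⇔Class : ∀ {X Y} → NonUniform 𝒞 X Y → ∀ W → InD 𝒞 X Y W ⇔ Class 𝒞 X Y W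
  InD⇔Class {X} {Y} nu W = mk⇔ ⇒class class⇒
    where
    ⇒class : InD 𝒞 X Y W → Class 𝒞 X Y W
    ⇒class (inj₁ W≡X)                          = inj₁ W≡X
    ⇒class (inj₂ (inj₁ refl))                  = inj₂ (NonUniform-sym 𝒞 nu , Connected-refl 𝒞)
    ⇒class (inj₂ (inj₂ (nuWX , (_ , _ , det)))) = inj₂ (nuWX , DetRel⇔⇒Connected 𝒞 det)
    class⇒ : Class 𝒞 X Y W → InD 𝒞 X Y W
    class⇒ (inj₁ W≡X)          = inj₁ W≡X
    class⇒ (inj₂ (nuWX , conn)) =
      inj₂ (inj₂ (nuWX , (type2K22 (NonUniform-sym 𝒞 nu) , type2K22 nuWX , Connected⇒DetRel⇔ 𝒞 conn)))

  InD? : ∀ {X Y} → NonUniform 𝒞 X Y → ∀ W → Dec (InD 𝒞 X Y W)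
  InD? {X} {Y} nu W = map′ (from (InD⇔Class nu W)) (to (InD⇔Class nu W)) (Class? 𝒞 X Y W)

  class-nonUniform : ∀ {X Y A B} → Class 𝒞 X Y A → Class 𝒞 X Y B → A ≢ B → NonUniform 𝒞 A B
  class-nonUniform (inj₁ refl)         (inj₁ refl)         A≢B = contradiction refl A≢B
  class-nonUniform (inj₁ refl)         (inj₂ (nuB , _))    _   = NonUniform-sym 𝒞 nuB
  class-nonUniform (inj₂ (nuA , _))    (inj₁ refl)         _   = nuA
  class-nonUniform (inj₂ (nuA , conA)) (inj₂ (nuB , conB)) A≢B =
    Connection.nuXZ nuA nuB A≢B (Connected-trans 𝒞 (Connected-sym 𝒞 conA) conB)

  class-determined : ∀ {X Y A B} → Class 𝒞 X Y A → Class 𝒞 X Y B → A ≢ B → ∀ W → Class 𝒞 X Y W ⇔ Class 𝒞 A B W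
  class-determined (inj₁ refl) (inj₁ refl) A≢B W = contradiction refl A≢B
  class-determined {X} {Y} {A} {B} (inj₁ refl) (inj₂ (nuB , conB)) _ W = mk⇔ ⇒class class⇒
    where
    ⇒class : Class 𝒞 X Y W → Class 𝒞 X B W
    ⇒class (inj₁ W≡X)          = inj₁ W≡X
    ⇒class (inj₂ (nuW , conW)) = inj₂ (nuW , Connected-trans 𝒞 (Connected-sym 𝒞 conB) conW)
    class⇒ : Class 𝒞 X B W → Class 𝒞 X Y W
    class⇒ (inj₁ W≡X)          = inj₁ W≡X
    class⇒ (inj₂ (nuW , conW)) = inj₂ (nuW , Connected-trans 𝒞 conB conW)
  class-determined {X} {Y} {A} {B} (inj₂ (nuA , conA)) B∈ A≢B W = mk⇔ ⇒class class⇒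
    where
    connected-at-A : ∀ {V} → Class 𝒞 X Y V → V ≢ A → NonUniform 𝒞 V A × Connected 𝒞 X V A
    connected-at-A (inj₁ refl) _ = NonUniform-sym 𝒞 nuA , Connected-refl 𝒞
    connected-at-A (inj₂ (nuV , conV)) V≢A =
      NonUniform-sym 𝒞 (Connection.nuXZ nuA nuV (V≢A ∘ sym) conAV) ,
      Connection.connected-at-X nuA nuV (V≢A ∘ sym) conAV
      where conAV = Connected-trans 𝒞 (Connected-sym 𝒞 conA) conV
    conXB : Connected 𝒞 X B A
    conXB = proj₂ (connected-at-A B∈ (A≢B ∘ sym))
    ⇒class : Class 𝒞 X Y W → Class 𝒞 A B W
    ⇒class W∈ with W ≟ A
    ... | yes W≡A = inj₁ W≡A
    ... | no W≢A  = let nuWA , conW = connected-at-A W∈ W≢A in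
                    inj₂ (nuWA , Connected-trans 𝒞 (Connected-sym 𝒞 conXB) conW)
    class⇒ : Class 𝒞 A B W → Class 𝒞 X Y W
    class⇒ (inj₁ refl) = inj₂ (nuA , conA)
    class⇒ (inj₂ (nuW , conW)) with W ≟ X
    ... | yes W≡X = inj₁ W≡X
    ... | no W≢X  =
      inj₂ (NonUniform-sym 𝒞 (Connection.nuXZ nuAX nuW (W≢X ∘ sym) conXW) ,
            Connected-trans 𝒞 conA (Connection.connected-at-X nuAX nuW (W≢X ∘ sym) conXW))
      where
      nuAX = NonUniform-sym 𝒞 nuA
      conXW = Connected-trans 𝒞 conXB conW

-- The maps f_S

module EdgeFlip (𝒞 : CC) (irr : Irredundant 𝒞) (S : Fin (CC.m 𝒞) → Fin (CC.m 𝒞) → Set)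
                (S? : ∀ X Y → Dec (S X Y)) (S⇒nonUniform : ∀ X Y → S X Y → NonUniform 𝒞 X Y) where
  open CC 𝒞

  edge : Fin m → Fin m → Bool
  edge A B = does (S? A B ⊎-dec S? B A)

  f : Fin m → Fin m
  f = fS 𝒞 S S?

  f-colour : ∀ {u v A B} → _∈F_ 𝒞 u A → _∈F_ 𝒞 v B → f (c u v) ≡ flipIf 𝒞 (edge A B) (c u v)
  f-colour u∈ v∈ = cong₂ (λ A B → flipIf 𝒞 (edge A B) _) (trans (src-colour 𝒞 refl) u∈) (trans (tgt-colour 𝒞 refl) v∈)

  edge-sym : ∀ A B → edge A B ≡ edge B A
  edge-sym A B = ∨-comm (does (S? A B)) (does (S? B A))

  edge≡true⇔ : ∀ {A B} → (edge A B ≡ true) ⇔ (S A B ⊎ S B A)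
  edge≡true⇔ {A} {B} with S? A B | S? B A
  ... | yes sAB | _       = mk⇔ (λ _ → inj₁ sAB) (λ _ → refl)
  ... | no _    | yes sBA = mk⇔ (λ _ → inj₂ sBA) (λ _ → refl)
  ... | no ¬sAB | no ¬sBA = mk⇔ (λ ()) (λ s → contradiction s [ ¬sAB , ¬sBA ]′)

  edge⇒nonUniform : ∀ {A B} → edge A B ≡ true → NonUniform 𝒞 A B
  edge⇒nonUniform edge≡ with to edge≡true⇔ edge≡
  ... | inj₁ sAB = S⇒nonUniform _ _ sAB
  ... | inj₂ sBA = NonUniform-sym 𝒞 (S⇒nonUniform _ _ sBA)

  ¬nonUniform⇒edge≡false : ∀ {A B} → ¬ NonUniform 𝒞 A B → edge A B ≡ false
  ¬nonUniform⇒edge≡false ¬nu = ¬-not (¬nu ∘ edge⇒nonUniform)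

  edge-refl : ∀ A → edge A A ≡ false
  edge-refl A = ¬nonUniform⇒edge≡false (NonUniform-irrefl 𝒞)

  f-fixes-uniform : ∀ {u v} → ¬ NonUniform 𝒞 (c u u) (c v v) → f (c u v) ≡ c u v
  f-fixes-uniform ¬nu = trans (f-colour refl refl) (cong (λ b → flipIf 𝒞 b _) (¬nonUniform⇒edge≡false ¬nu))

  f-fixes-fiber : ∀ {u v} → c u u ≡ c v v → f (c u v) ≡ c u v
  f-fixes-fiber uu≡vv = f-fixes-uniform (λ nu → NonUniform-irrefl 𝒞 (subst (NonUniform 𝒞 _) (sym uu≡vv) nu))

  f-fixes-cells : ∀ j → InCell 𝒞 j → f j ≡ j
  f-fixes-cells j (_ , _ , cell) =
    subst (λ k → f k ≡ k) (rep-ok j) (f-fixes-fiber (trans (proj₁ (cell _ _ (rep-ok j))) (sym (proj₂ (cell _ _ (rep-ok j))))))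

  f-src : ∀ j → src 𝒞 (f j) ≡ src 𝒞 j
  f-src j = flipIf-src 𝒞 _ j

  f-tgt : ∀ j → tgt 𝒞 (f j) ≡ tgt 𝒞 j
  f-tgt j = flipIf-tgt 𝒞 _ j

  f-involutive : ∀ j → f (f j) ≡ j
  f-involutive j = begin
    f (f j)                                ≡⟨ cong₂ (λ A B → flipIf 𝒞 (edge A B) (f j)) (f-src j) (f-tgt j) ⟩
    flipIf 𝒞 e (flipIf 𝒞 e j)              ≡⟨ flipIf-flipIf 𝒞 irr e e j edge⇒nonUniform ⟩
    flipIf 𝒞 (e xor e) j                   ≡⟨ cong (λ b → flipIf 𝒞 b j) (xor-same e) ⟩
    j                                      ∎
    where
    open ≡-Reasoning
    e = edge (src 𝒞 j) (tgt 𝒞 j)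

  f-injective : ∀ {a b} → f a ≡ f b → a ≡ b
  f-injective {a} {b} eq = trans (sym (f-involutive a)) (trans (cong f eq) (f-involutive b))

  CutCond⇒potential : ∀ {C} → CutCond 𝒞 S C → Σ (Fin m → Bool) λ side → ∀ {U V} → C U → C V → edge U V ≡ side U xor side V
  CutCond⇒potential (inj₁ none) = (λ _ → false) , λ U∈ V∈ → ¬-not (none _ _ U∈ V∈ ∘ to edge≡true⇔)
  CutCond⇒potential {C} (inj₂ (side , _ , _ , cut)) = side , potential
    where
    potential : ∀ {U V} → C U → C V → edge U V ≡ side U xor side V
    potential {U} {V} U∈ V∈ with U ≟ V
    ... | yes refl = trans (edge-refl U) (sym (xor-same (side U)))
    ... | no U≢V = ≡true⇔⇒≡ (⇔-trans edge≡true⇔ (⇔-trans (cut U V U∈ V∈ U≢V) ≢⇔xor≡true))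

  CutCond⇒triangle : ∀ {C} → CutCond 𝒞 S C → ∀ {A B D} → C A → C B → C D → edge A D ≡ edge A B xor edge B D
  CutCond⇒triangle cut A∈ B∈ D∈ with CutCond⇒potential cut
  ... | side , potential = trans (potential A∈ D∈)
    (trans (sym (xor-telescope (side _) (side _) (side _))) (sym (cong₂ _xor_ (potential A∈ B∈) (potential B∈ D∈))))

  target-image : ∀ x z → Σ (Fin n) λ z' → c z' z' ≡ c z z × (∀ u → c u u ≡ c x x → c u z' ≡ f (c u z))
  target-image x z with edge (c x x) (c z z) in edge≡
  ... | false = z , refl , λ u u∈ → sym (trans (f-colour u∈ refl) (cong (λ b → flipIf 𝒞 b _) edge≡))
  ... | true  = flipY z , ptY-∈ _ , λ u u∈ →
    trans (from (colour-shift u∈ refl u∈ (ptY-∈ _) true) (trans (bit-flipY u z) (sym (xor-true _))))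
          (sym (trans (f-colour u∈ refl) (cong (λ b → flipIf 𝒞 b _) edge≡)))
    where open Coordinates 𝒞 (type2K22 𝒞 irr (edge⇒nonUniform edge≡))

  source-image : ∀ x z → Σ (Fin n) λ x' → c x' x' ≡ c x x × (∀ v → c v v ≡ c z z → c x' v ≡ f (c x v))
  source-image x z with edge (c x x) (c z z) in edge≡
  ... | false = x , refl , λ v v∈ → sym (trans (f-colour refl v∈) (cong (λ b → flipIf 𝒞 b _) edge≡))
  ... | true  = flipX x , ptX-∈ _ , λ v v∈ →
    trans (from (colour-shift refl v∈ (ptX-∈ _) v∈ true) (trans (bit-flipX x v) (sym (xor-true _))))
          (sym (trans (f-colour refl v∈) (cong (λ b → flipIf 𝒞 b _) edge≡)))
    where open Coordinates 𝒞 (type2K22 𝒞 irr (edge⇒nonUniform edge≡))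

  -- Enough to transport, via p-preserved, the paths x – w – z with w ∈ Y to paths x' – σ w – z'.
  record LocalImage (x z : Fin n) (Y : Fin m) : Set where
    field
      x' z'         : Fin n
      σ             : Fin n → Fin n
      σ-involutive  : ∀ w → σ (σ w) ≡ w
      σ-fiber       : ∀ w → c (σ w) (σ w) ≡ c w w
      x'z'≡         : c x' z' ≡ f (c x z)
      image         : ∀ w → _∈F_ 𝒞 w Y → c x' (σ w) ≡ f (c x w) × c (σ w) z' ≡ f (c w z)

  module _ {x z : Fin n} where
    private
      X = c x x
      Z = c z z

    image-at-source : LocalImage x z X
    image-at-source = record
      { x' = x ; z' = z' ; σ = id ; σ-involutive = λ _ → refl ; σ-fiber = λ _ → refl
      ; x'z'≡ = column x refl
      ; image = λ w w∈ → sym (f-fixes-fiber (sym w∈)) , column w w∈ }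
      where
      z' = proj₁ (target-image x z)
      column = proj₂ (proj₂ (target-image x z))

    image-at-target : LocalImage x z Z
    image-at-target = record
      { x' = x' ; z' = z ; σ = id ; σ-involutive = λ _ → refl ; σ-fiber = λ _ → refl
      ; x'z'≡ = row z refl
      ; image = λ w w∈ → row w w∈ , sym (f-fixes-fiber w∈) }
      where
      x' = proj₁ (source-image x z)
      row = proj₂ (proj₂ (source-image x z))

    module _ {Y} (Y≢X : Y ≢ X) (Y≢Z : Y ≢ Z) where

      private
        fixed-row : ¬ NonUniform 𝒞 X Y → ∀ {w w'} → _∈F_ 𝒞 w Y → _∈F_ 𝒞 w' Y → c x w' ≡ f (c x w)
        fixed-row ¬nu w∈ w'∈ =
          trans (¬NonUniform⇒Uniform 𝒞 (loop-isFiber 𝒞 x) (subst (IsFiber 𝒞) w∈ (loop-isFiber 𝒞 _)) (Y≢X ∘ sym) ¬nu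
                   x _ x _ refl w'∈ refl w∈)
                (sym (f-fixes-uniform (¬nu ∘ subst (NonUniform 𝒞 X) w∈)))

        fixed-column : ¬ NonUniform 𝒞 Z Y → ∀ {z' w w'} → _∈F_ 𝒞 z' Z → _∈F_ 𝒞 w Y → _∈F_ 𝒞 w' Y → c w' z' ≡ f (c w z)
        fixed-column ¬nu z'∈ w∈ w'∈ =
          trans (¬NonUniform⇒Uniform 𝒞 (subst (IsFiber 𝒞) w∈ (loop-isFiber 𝒞 _)) (loop-isFiber 𝒞 z) Y≢Z
                   (¬nu ∘ NonUniform-sym 𝒞) _ _ _ _ w'∈ z'∈ w∈ refl)
                (sym (f-fixes-uniform (¬nu ∘ NonUniform-sym 𝒞 ∘ subst (λ V → NonUniform 𝒞 V Z) w∈)))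

      image-apart : ¬ NonUniform 𝒞 X Y → ¬ NonUniform 𝒞 Z Y → LocalImage x z Y
      image-apart ¬nuXY ¬nuZY = record
        { x' = x ; z' = z' ; σ = id ; σ-involutive = λ _ → refl ; σ-fiber = λ _ → refl
        ; x'z'≡ = proj₂ (proj₂ (target-image x z)) x refl
        ; image = λ w w∈ → fixed-row ¬nuXY w∈ w∈ , fixed-column ¬nuZY z'∈ w∈ w∈ }
        where
        z' = proj₁ (target-image x z)
        z'∈ = proj₁ (proj₂ (target-image x z))

      image-via-target : ¬ NonUniform 𝒞 X Y → NonUniform 𝒞 Z Y → LocalImage x z Y
      image-via-target ¬nuXY nuZY = record
        { x' = x ; z' = z' ; σ = K.shiftY s
        ; σ-involutive = K.translateY-involutive _ ; σ-fiber = K.translateY-fiber _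
        ; x'z'≡ = column x refl
        ; image = λ w w∈ → fixed-row ¬nuXY w∈ (σ∈ w∈) , column-image w∈ }
        where
        module K = Coordinates 𝒞 (type2K22 𝒞 irr nuZY)
        z' = proj₁ (target-image x z)
        z'∈ = proj₁ (proj₂ (target-image x z))
        column = proj₂ (proj₂ (target-image x z))
        d = K.bX z xor K.bX z'
        e = edge Y Z
        s = d xor e
        σ∈ : ∀ {w} → _∈F_ 𝒞 w Y → _∈F_ 𝒞 (K.shiftY s w) Y
        σ∈ w∈ = trans (K.translateY-fiber _ _) w∈
        column-image : ∀ {w} → _∈F_ 𝒞 w Y → c (K.shiftY s w) z' ≡ f (c w z)
        column-image w∈ =
          trans (flipIf-transpose 𝒞 irr nuZY refl z'∈ w∈ (σ∈ w∈) e
                  (trans (K.colour-shift-bits refl z'∈ w∈ (σ∈ w∈) d s (sym (xor-involutiveˡ (K.bX z) (K.bX z')))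
                                              (K.bY-shiftY s w∈))
                         (cong (λ b → flipIf 𝒞 b _) (xor-involutiveˡ d e))))
                (sym (f-colour w∈ refl))

      image-via-source : NonUniform 𝒞 X Y → ¬ NonUniform 𝒞 Z Y → LocalImage x z Y
      image-via-source nuXY ¬nuZY = record
        { x' = x' ; z' = z ; σ = K.shiftY s
        ; σ-involutive = K.translateY-involutive _ ; σ-fiber = K.translateY-fiber _
        ; x'z'≡ = row z refl
        ; image = λ w w∈ → row-image w∈ , fixed-column ¬nuZY refl w∈ (σ∈ w∈) }
        where
        module K = Coordinates 𝒞 (type2K22 𝒞 irr nuXY)
        x' = proj₁ (source-image x z)
        x'∈ = proj₁ (proj₂ (source-image x z))
        row = proj₂ (proj₂ (source-image x z))
        d = K.bX x xor K.bX x'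
        e = edge X Y
        s = d xor e
        σ∈ : ∀ {w} → _∈F_ 𝒞 w Y → _∈F_ 𝒞 (K.shiftY s w) Y
        σ∈ w∈ = trans (K.translateY-fiber _ _) w∈
        row-image : ∀ {w} → _∈F_ 𝒞 w Y → c x' (K.shiftY s w) ≡ f (c x w)
        row-image w∈ =
          trans (trans (K.colour-shift-bits refl x'∈ w∈ (σ∈ w∈) d s (sym (xor-involutiveˡ (K.bX x) (K.bX x')))
                                            (K.bY-shiftY s w∈))
                       (cong (λ b → flipIf 𝒞 b _) (xor-involutiveˡ d e)))
                (sym (f-colour refl w∈))

      image-loop : NonUniform 𝒞 X Y → X ≡ Z → LocalImage x z Y
      image-loop nuXY X≡Z = record
        { x' = x ; z' = z ; σ = K.shiftY e
        ; σ-involutive = K.translateY-involutive _ ; σ-fiber = K.translateY-fiber _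
        ; x'z'≡ = sym (f-fixes-fiber X≡Z)
        ; image = λ w w∈ → row-image w∈ , column-image w∈ }
        where
        module K = Coordinates 𝒞 (type2K22 𝒞 irr nuXY)
        e = edge X Y
        z∈ : _∈F_ 𝒞 z X
        z∈ = sym X≡Z
        σ∈ : ∀ {w} → _∈F_ 𝒞 w Y → _∈F_ 𝒞 (K.shiftY e w) Y
        σ∈ w∈ = trans (K.translateY-fiber _ _) w∈
        shifted : ∀ {u w} → _∈F_ 𝒞 u X → _∈F_ 𝒞 w Y → c u (K.shiftY e w) ≡ flipIf 𝒞 e (c u w)
        shifted u∈ w∈ = K.colour-shift-bits u∈ u∈ w∈ (σ∈ w∈) false e (sym (xor-identityʳ _)) (K.bY-shiftY e w∈)
        row-image : ∀ {w} → _∈F_ 𝒞 w Y → c x (K.shiftY e w) ≡ f (c x w)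
        row-image w∈ = trans (shifted refl w∈) (sym (f-colour refl w∈))
        column-image : ∀ {w} → _∈F_ 𝒞 w Y → c (K.shiftY e w) z ≡ f (c w z)
        column-image w∈ =
          trans (flipIf-transpose 𝒞 irr nuXY z∈ z∈ w∈ (σ∈ w∈) e (shifted z∈ w∈))
                (sym (trans (f-colour w∈ z∈) (cong (λ b → flipIf 𝒞 b _) (edge-sym Y X))))

      image-connected : (nuXY : NonUniform 𝒞 X Y) (nuZY : NonUniform 𝒞 Z Y) (X≢Z : X ≢ Z) → Connected 𝒞 X Z Y →
                        edge X Z ≡ edge X Y xor edge Y Z → LocalImage x z Y
      image-connected nuXY nuZY X≢Z conn triangle = record
        { x' = x ; z' = z' ; σ = K₁.shiftY eXY
        ; σ-involutive = K₁.translateY-involutive _ ; σ-fiber = K₁.translateY-fiber _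
        ; x'z'≡ = trans (from (T.colour-shift-β refl refl refl z'∈ d) β≡)
                        (sym (trans (f-colour refl refl) (cong (λ b → flipIf 𝒞 b _) triangle)))
        ; image = λ w w∈ → row-image w∈ , column-image w∈ }
        where
        module T = Connection 𝒞 irr nuXY nuZY X≢Z conn
        module K₁ = T.K₁
        module K₂ = T.K₂
        eXY = edge X Y
        eYZ = edge Y Z
        d = eXY xor eYZ
        z' = K₂.shiftX d z
        z'∈ = K₂.shiftX-∈ d refl
        β≡ : T.β x z' ≡ T.β x z xor d
        β≡ = trans (cong (K₁.bX x xor_) (K₂.bX-shiftX d z)) (sym (xor-assoc (K₁.bX x) _ d))
        σ∈ : ∀ {w} → _∈F_ 𝒞 w Y → _∈F_ 𝒞 (K₁.shiftY eXY w) Y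
        σ∈ w∈ = trans (K₁.translateY-fiber _ _) w∈
        row-image : ∀ {w} → _∈F_ 𝒞 w Y → c x (K₁.shiftY eXY w) ≡ f (c x w)
        row-image w∈ =
          trans (K₁.colour-shift-bits refl refl w∈ (σ∈ w∈) false eXY (sym (xor-identityʳ _)) (K₁.bY-shiftY eXY w∈))
                (sym (f-colour refl w∈))
        bY₂-shift : ∀ {w} → _∈F_ 𝒞 w Y → K₂.bY (K₁.shiftY eXY w) ≡ K₂.bY w xor eXY
        bY₂-shift {w} w∈ = begin
          K₂.bY (K₁.shiftY eXY w)            ≡⟨ T.bY₂≡bY₁xorδ (σ∈ w∈) ⟩
          K₁.bY (K₁.shiftY eXY w) xor T.δ    ≡⟨ cong (_xor T.δ) (K₁.bY-shiftY eXY w∈) ⟩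
          (K₁.bY w xor eXY) xor T.δ          ≡⟨ xor-right-comm (K₁.bY w) eXY T.δ ⟩
          (K₁.bY w xor T.δ) xor eXY          ≡⟨ cong (_xor eXY) (T.bY₂≡bY₁xorδ w∈) ⟨
          K₂.bY w xor eXY                    ∎
          where open ≡-Reasoning
        column-image : ∀ {w} → _∈F_ 𝒞 w Y → c (K₁.shiftY eXY w) z' ≡ f (c w z)
        column-image w∈ =
          trans (flipIf-transpose 𝒞 irr nuZY refl z'∈ w∈ (σ∈ w∈) eYZ
                  (trans (K₂.colour-shift-bits refl z'∈ w∈ (σ∈ w∈) d eXY (K₂.bX-shiftX d z) (bY₂-shift w∈))
                         (cong (λ b → flipIf 𝒞 b _) (trans (xor-comm d eXY) (xor-involutiveˡ eXY eYZ)))))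
                (sym (f-colour w∈ refl))

      image-twisted : (nuXY : NonUniform 𝒞 X Y) (nuZY : NonUniform 𝒞 Z Y) → ¬ Connected 𝒞 X Z Y → LocalImage x z Y
      image-twisted nuXY nuZY ¬conn = record
        { x' = x ; z' = z' ; σ = K₁.translateY k
        ; σ-involutive = K₁.translateY-involutive k ; σ-fiber = K₁.translateY-fiber k
        ; x'z'≡ = column x refl
        ; image = λ w w∈ → row-image w∈ , column-image w∈ }
        where
        module K₁ = Coordinates 𝒞 (type2K22 𝒞 irr nuXY)
        module K₂ = Coordinates 𝒞 (type2K22 𝒞 irr nuZY)
        z' = proj₁ (target-image x z)
        z'∈ = proj₁ (proj₂ (target-image x z))
        column = proj₂ (proj₂ (target-image x z))
        eXY = edge X Y
        eYZ = edge Y Z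
        d = K₂.bX z xor K₂.bX z'
        s = d xor eYZ
        shift = independent-shifts 𝒞 irr nuXY nuZY ¬conn eXY s
        k = proj₁ shift
        σ∈ : ∀ {w} → _∈F_ 𝒞 w Y → _∈F_ 𝒞 (K₁.translateY k w) Y
        σ∈ w∈ = trans (K₁.translateY-fiber _ _) w∈
        row-image : ∀ {w} → _∈F_ 𝒞 w Y → c x (K₁.translateY k w) ≡ f (c x w)
        row-image w∈ =
          trans (K₁.colour-shift-bits refl refl w∈ (σ∈ w∈) false eXY (sym (xor-identityʳ _)) (proj₁ (proj₂ shift w∈)))
                (sym (f-colour refl w∈))
        column-image : ∀ {w} → _∈F_ 𝒞 w Y → c (K₁.translateY k w) z' ≡ f (c w z)
        column-image w∈ =
          trans (flipIf-transpose 𝒞 irr nuZY refl z'∈ w∈ (σ∈ w∈) eYZ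
                  (trans (K₂.colour-shift-bits refl z'∈ w∈ (σ∈ w∈) d s (sym (xor-involutiveˡ (K₂.bX z) (K₂.bX z')))
                                               (proj₂ (proj₂ shift w∈)))
                         (cong (λ b → flipIf 𝒞 b _) (xor-involutiveˡ d eYZ))))
                (sym (f-colour w∈ refl))

  CutConditions : Set
  CutConditions = ∀ X Y → NonUniform 𝒞 X Y → CutCond 𝒞 S (InD 𝒞 X Y)

  local-image : CutConditions → ∀ x z Y → LocalImage x z Y
  local-image cut x z Y with Y ≟ c x x
  ... | yes refl = image-at-source
  ... | no Y≢X with Y ≟ c z z
  ...   | yes refl = image-at-target
  ...   | no Y≢Z with NonUniform? 𝒞 (c x x) Y | NonUniform? 𝒞 (c z z) Y
  ...     | no ¬nuXY | no ¬nuZY = image-apart Y≢X Y≢Z ¬nuXY ¬nuZY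
  ...     | no ¬nuXY | yes nuZY = image-via-target Y≢X Y≢Z ¬nuXY nuZY
  ...     | yes nuXY | no ¬nuZY = image-via-source Y≢X Y≢Z nuXY ¬nuZY
  ...     | yes nuXY | yes nuZY with c x x ≟ c z z
  ...       | yes X≡Z = image-loop Y≢X Y≢Z nuXY X≡Z
  ...       | no X≢Z with Connected? 𝒞 (c x x) (c z z) Y
  ...         | no ¬conn = image-twisted Y≢X Y≢Z nuXY nuZY ¬conn
  ...         | yes conn = image-connected Y≢X Y≢Z nuXY nuZY X≢Z conn
                             (CutCond⇒triangle (cut Y (c x x) nuYX) (inj₂ (inj₁ refl)) (inj₁ refl)
                                               (from (InD⇔Class 𝒞 irr nuYX (c z z)) (inj₂ (nuZY , conn))))
    where nuYX = NonUniform-sym 𝒞 nuXY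

  cut⇒strictAlgAut : CutConditions → StrictAlgAut 𝒞 f
  cut⇒strictAlgAut cut = (f-injective , λ j → f j , λ i≡fj → trans (cong f i≡fj) (f-involutive j)) ,
                          p-preserving , f-fixes-cells
    where
    p-preserving : ∀ T R U → p 𝒞 T R U ≡ p 𝒞 (f T) (f R) (f U)
    p-preserving T R U =
      p-preserved 𝒞 f f-injective f-tgt T R U σ σ-involutive σ-fiber (rep-ok T) (trans x'z'≡ (cong f (rep-ok T))) image
      where open LocalImage (local-image cut (proj₁ (rep T)) (proj₂ (rep T)) (tgt 𝒞 R))

  module _ (pres : PreservesIntersectionNumbers 𝒞 f) where

    connected-triangle : ∀ {A B X} (nuAX : NonUniform 𝒞 A X) (nuBX : NonUniform 𝒞 B X) (A≢B : A ≢ B) →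
                         Connected 𝒞 A B X → edge A B ≡ edge A X xor edge X B
    connected-triangle {A} {B} {X} nuAX nuBX A≢B conn = xor-cancelˡ (T.β a b xor T.δ) (begin
      (T.β a b xor T.δ) xor edge A B                        ≡⟨ xor-right-comm (T.β a b) T.δ (edge A B) ⟩
      (T.β a b xor edge A B) xor T.δ                        ≡⟨ cong (_xor T.δ) β-shift ⟨
      T.β a' b' xor T.δ                                     ≡⟨ T.bits≡β a' b' w'∈ ⟨
      K₁.bit a' w' xor K₂.bit b' w'                         ≡⟨ cong₂ _xor_ bit₁-shift bit₂-shift ⟩
      (K₁.bit a w xor edge A X) xor (K₂.bit b w xor edge X B) ≡⟨ xor-interchange (K₁.bit a w) _ _ _ ⟩
      (K₁.bit a w xor K₂.bit b w) xor (edge A X xor edge X B) ≡⟨ cong (_xor _) (T.bits≡β a b w∈) ⟩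
      (T.β a b xor T.δ) xor (edge A X xor edge X B)         ∎)
      where
      open ≡-Reasoning
      module T = Connection 𝒞 irr nuAX nuBX A≢B conn
      module K₁ = T.K₁
      module K₂ = T.K₂
      a = K₁.ptX true
      a∈ = K₁.ptX-∈ true
      w = K₁.ptY true
      w∈ = K₁.ptY-∈ true
      b = K₂.ptX true
      b∈ = K₂.ptX-∈ true
      image = path-image 𝒞 f pres (w , refl , refl)
      a' = proj₁ (rep (f (c a b)))
      b' = proj₂ (rep (f (c a b)))
      w' = proj₁ image
      a'w'≡ : c a' w' ≡ f (c a w)
      a'w'≡ = proj₁ (proj₂ image)
      w'b'≡ : c w' b' ≡ f (c w b)
      w'b'≡ = proj₂ (proj₂ image)
      a'∈ : _∈F_ 𝒞 a' A
      a'∈ = trans (f-src (c a b)) (trans (src-colour 𝒞 refl) a∈)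
      b'∈ : _∈F_ 𝒞 b' B
      b'∈ = trans (f-tgt (c a b)) (trans (tgt-colour 𝒞 refl) b∈)
      w'∈ : _∈F_ 𝒞 w' X
      w'∈ = trans (sym (tgt-colour 𝒞 a'w'≡)) (trans (f-tgt (c a w)) (trans (tgt-colour 𝒞 refl) w∈))
      bit₁-shift : K₁.bit a' w' ≡ K₁.bit a w xor edge A X
      bit₁-shift = to (K₁.colour-shift a∈ w∈ a'∈ w'∈ (edge A X)) (trans a'w'≡ (f-colour a∈ w∈))
      bit₂-shift : K₂.bit b' w' ≡ K₂.bit b w xor edge X B
      bit₂-shift = to (K₂.colour-shift b∈ w∈ b'∈ w'∈ (edge X B))
        (flipIf-transpose 𝒞 irr (NonUniform-sym 𝒞 nuBX) w∈ w'∈ b∈ b'∈ (edge X B) (trans w'b'≡ (f-colour w∈ b∈)))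
      β-shift : T.β a' b' ≡ T.β a b xor edge A B
      β-shift = to (T.colour-shift-β a∈ b∈ a'∈ b'∈ (edge A B)) (trans (rep-ok (f (c a b))) (f-colour a∈ b∈))

    class-triangle : ∀ {X Y U V} → Class 𝒞 X Y U → Class 𝒞 X Y V → edge U V ≡ edge X U xor edge X V
    class-triangle {X} {V = V} (inj₁ refl) _ = cong (_xor edge X V) (sym (edge-refl X))
    class-triangle {U = U} (inj₂ _) (inj₁ refl) =
      trans (edge-sym U _) (trans (sym (xor-identityʳ _)) (cong (edge _ U xor_) (sym (edge-refl _))))
    class-triangle {U = U} {V} (inj₂ (nuU , conU)) (inj₂ (nuV , conV)) with U ≟ V
    ... | yes refl = trans (edge-refl U) (sym (xor-same (edge _ U)))
    ... | no U≢V = trans (connected-triangle nuU nuV U≢V (Connected-trans 𝒞 (Connected-sym 𝒞 conU) conV))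
                         (cong (_xor edge _ V) (edge-sym U _))

  strictAlgAut⇒cut : StrictAlgAut 𝒞 f → CutConditions
  strictAlgAut⇒cut (_ , pres , _) X Y nu with any? (λ A → InD? 𝒞 irr nu A ×-dec (edge X A Bool.≟ true))
  ... | yes (A , A∈ , edge≡true) =
    inj₂ (edge X , (A , A∈ , edge≡true) , (X , inj₁ refl , edge-refl X) , λ U V U∈ V∈ U≢V →
      ⇔-trans (⇔-sym edge≡true⇔) (⇔-trans (≡-⇔-cong (triangle U∈ V∈) refl) (⇔-sym ≢⇔xor≡true)))
    where triangle = λ {U V} U∈ V∈ → class-triangle pres (to (InD⇔Class 𝒞 irr nu U) U∈) (to (InD⇔Class 𝒞 irr nu V) V∈)
  ... | no ∄A = inj₁ λ U V U∈ V∈ edgeUV →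
    contradiction (trans (sym (from edge≡true⇔ edgeUV))
                         (trans (class-triangle pres (to (InD⇔Class 𝒞 irr nu U) U∈) (to (InD⇔Class 𝒞 irr nu V) V∈))
                                (cong₂ _xor_ (no-edge U∈) (no-edge V∈))))
                  λ ()
    where
    no-edge : ∀ {A} → InD 𝒞 X Y A → edge X A ≡ false
    no-edge A∈ = ¬-not λ edge≡true → ∄A (_ , A∈ , edge≡true)

-- Generators and strict algebraic automorphisms

module _ (𝒞 : CC) (irr : Irredundant 𝒞) (g : Gen 𝒞) where
  open CC 𝒞
  open Gen g

  private
    X∈class : Class 𝒞 Y Z X
    X∈class = to (InD⇔Class 𝒞 irr nonunif X) X∈C

  genS⇒nonUniform : ∀ A B → genS 𝒞 g A B → NonUniform 𝒞 A B
  genS⇒nonUniform A B (refl , B∈ , B≢X) = class-nonUniform 𝒞 irr X∈class (to (InD⇔Class 𝒞 irr nonunif B) B∈) (B≢X ∘ sym)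

  genS-cut : ∀ U V → NonUniform 𝒞 U V → CutCond 𝒞 (genS 𝒞 g) (InD 𝒞 U V)
  genS-cut U V nuUV with InD? 𝒞 irr nuUV X ×-dec any? (λ B → InD? 𝒞 irr nuUV B ×-dec (C? B ×-dec ¬? (B ≟ X)))
  ... | no ¬shared = inj₁ λ where
    A A' A∈ A'∈ (inj₁ (refl , A'∈C , A'≢X)) → ¬shared (A∈ , A' , A'∈ , A'∈C , A'≢X)
    A A' A∈ A'∈ (inj₂ (refl , A∈C , A≢X))   → ¬shared (A'∈ , A , A∈ , A∈C , A≢X)
  ... | yes (X∈ , B , B∈ , B∈C , B≢X) =
    inj₂ (side , (X , X∈ , dec-true (X ≟ X) refl) , (B , B∈ , dec-false (B ≟ X) B≢X) , star)
    where
    side : Fin m → Bool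
    side A = does (A ≟ X)
    ⊆C : ∀ W → InD 𝒞 U V W → InD 𝒞 Y Z W
    ⊆C W W∈ = from (InD⇔Class 𝒞 irr nonunif W)
      (from (class-determined 𝒞 irr X∈class (to (InD⇔Class 𝒞 irr nonunif B) B∈C) (B≢X ∘ sym) W)
        (to (class-determined 𝒞 irr (to (InD⇔Class 𝒞 irr nuUV X) X∈) (to (InD⇔Class 𝒞 irr nuUV B) B∈) (B≢X ∘ sym) W)
          (to (InD⇔Class 𝒞 irr nuUV W) W∈)))
    star : ∀ A A' → InD 𝒞 U V A → InD 𝒞 U V A' → A ≢ A' →
           (genS 𝒞 g A A' ⊎ genS 𝒞 g A' A) ⇔ (side A ≢ side A')
    star A A' A∈ A'∈ A≢A' with A ≟ X | A' ≟ X
    ... | yes refl | yes refl = contradiction refl A≢A'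
    ... | yes refl | no A'≢X  = mk⇔ (λ _ ()) (λ _ → inj₁ (refl , ⊆C A' A'∈ , A'≢X))
    ... | no A≢X   | yes refl = mk⇔ (λ _ ()) (λ _ → inj₂ (refl , ⊆C A A∈ , A≢X))
    ... | no A≢X   | no A'≢X  = mk⇔ (λ { (inj₁ (A≡X , _)) → contradiction A≡X A≢X ; (inj₂ (A'≡X , _)) → contradiction A'≡X A'≢X })
                                     (λ false≢false → contradiction refl false≢false)

  fGen-strictAlgAut : StrictAlgAut 𝒞 (fGen 𝒞 g)
  fGen-strictAlgAut = EdgeFlip.cut⇒strictAlgAut 𝒞 irr (genS 𝒞 g) (genS? 𝒞 g) genS⇒nonUniform genS-cut

module _ (𝒞 : CC) (irr : Irredundant 𝒞) (f : Fin (CC.m 𝒞) → Fin (CC.m 𝒞)) (aut : StrictAlgAut 𝒞 f) where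
  open CC 𝒞

  private
    f-injective : ∀ {a b} → f a ≡ f b → a ≡ b
    f-injective = proj₁ (proj₁ aut)

    pres : PreservesIntersectionNumbers 𝒞 f
    pres = proj₁ (proj₂ aut)

  f-fixes-fiber : ∀ {u v} → c u u ≡ c v v → f (c u v) ≡ c u v
  f-fixes-fiber {u} uu≡vv = proj₂ (proj₂ aut) _
    (c u u , loop-isFiber 𝒞 u , λ a b ab≡ → source-fiber 𝒞 ab≡ , trans (target-fiber 𝒞 ab≡) (sym uu≡vv))

  f-source-∈ : ∀ u v → _∈F_ 𝒞 (proj₁ (rep (f (c u v)))) (c u u)
  f-source-∈ u v with path-image 𝒞 f pres (u , refl , refl)
  ... | w , a'w≡ , _ = trans (cong (c _) (loops u _ w (sym (trans a'w≡ (f-fixes-fiber refl))))) (trans a'w≡ (f-fixes-fiber refl))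

  f-target-∈ : ∀ u v → _∈F_ 𝒞 (proj₂ (rep (f (c u v)))) (c v v)
  f-target-∈ u v with path-image 𝒞 f pres (v , refl , refl)
  ... | w , _ , wb'≡ = trans (cong (λ a → c a _) (sym (loops v w _ (sym (trans wb'≡ (f-fixes-fiber refl))))))
                             (trans wb'≡ (f-fixes-fiber refl))

  f-fixes-or-flips : ∀ u v → f (c u v) ≡ c u v ⊎ (NonUniform 𝒞 (c u u) (c v v) × f (c u v) ≡ other 𝒞 (c u v))
  f-fixes-or-flips u v with NonUniform? 𝒞 (c u u) (c v v) | c a' b' ≟ c u v
    where
    a' = proj₁ (rep (f (c u v)))
    b' = proj₂ (rep (f (c u v)))
  ... | _ | yes a'b'≡ = inj₁ (trans (sym (rep-ok _)) a'b'≡)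
  ... | yes nu | no a'b'≢ = inj₂ (nu , trans (sym (rep-ok _))
      (Coordinates.≢⇒≡other 𝒞 (type2K22 𝒞 irr nu) refl refl (f-source-∈ u v) (f-target-∈ u v) a'b'≢))
  ... | no ¬nu | no a'b'≢ with c u u ≟ c v v
  ...   | yes uu≡vv = inj₁ (f-fixes-fiber uu≡vv)
  ...   | no uu≢vv  = contradiction (¬NonUniform⇒Uniform 𝒞 (loop-isFiber 𝒞 u) (loop-isFiber 𝒞 v) uu≢vv ¬nu
                                       _ _ _ _ (f-source-∈ u v) (f-target-∈ u v) refl refl) a'b'≢

  fixed-spreads : ∀ {A B} → NonUniform 𝒞 A B → ∀ {u v u' v'} → _∈F_ 𝒞 u A → _∈F_ 𝒞 v B → _∈F_ 𝒞 u' A → _∈F_ 𝒞 v' B →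
                  f (c u v) ≡ c u v → f (c u' v') ≡ c u' v'
  fixed-spreads nu {u} {v} {u'} {v'} u∈ v∈ u'∈ v'∈ fixed with c u' v' ≟ c u v
  ... | yes u'v'≡ = trans (cong f u'v'≡) (trans fixed (sym u'v'≡))
  ... | no u'v'≢ with f-fixes-or-flips u' v'
  ...   | inj₁ fixed' = fixed'
  ...   | inj₂ (_ , flipped) = contradiction (f-injective (trans flipped (trans other≡ (sym fixed)))) u'v'≢
    where
    open Coordinates 𝒞 (type2K22 𝒞 irr nu)
    other≡ : other 𝒞 (c u' v') ≡ c u v
    other≡ = trans (cong (other 𝒞) (≢⇒≡other u∈ v∈ u'∈ v'∈ u'v'≢)) (other-involutive u∈ v∈)

  fixed-transposes : ∀ {u v} → f (c u v) ≡ c u v → f (c v u) ≡ c v u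
  fixed-transposes {u} {v} fixed with path-image 𝒞 f pres (v , refl , refl)
  ... | w , rw≡ , wr'≡ = trans (sym wr≡) (transp _ _ _ _ (trans rw≡ fixed))
    where
    r = proj₁ (rep (f (c u u)))
    r' = proj₂ (rep (f (c u u)))
    r'≡r : r' ≡ r
    r'≡r = sym (loop-isFiber 𝒞 u _ _ (trans (rep-ok _) (f-fixes-fiber refl)))
    wr≡ : c w r ≡ f (c v u)
    wr≡ = subst (λ a → c w a ≡ f (c v u)) r'≡r wr'≡

  Flipped : Fin m → Fin m → Set
  Flipped A B = NonUniform 𝒞 A B × f (c (point 𝒞 A) (point 𝒞 B)) ≢ c (point 𝒞 A) (point 𝒞 B)

  Flipped? : ∀ A B → Dec (Flipped A B)
  Flipped? A B = NonUniform? 𝒞 A B ×-dec ¬? (f (c (point 𝒞 A) (point 𝒞 B)) ≟ c (point 𝒞 A) (point 𝒞 B))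

  f≗fS : ∀ j → f j ≡ fS 𝒞 Flipped Flipped? j
  f≗fS j = subst (λ k → f k ≡ F.f k) (rep-ok j) (on-colour _ _)
    where
    module F = EdgeFlip 𝒞 irr Flipped Flipped? (λ _ _ → proj₁)
    on-colour : ∀ u v → f (c u v) ≡ F.f (c u v)
    on-colour u v with f-fixes-or-flips u v
    ... | inj₁ fixed =
      trans fixed (sym (trans (F.f-colour refl refl) (cong (λ b → flipIf 𝒞 b _) (¬-not (unflipped ∘ to F.edge≡true⇔)))))
      where
      unflipped : ¬ (Flipped (c u u) (c v v) ⊎ Flipped (c v v) (c u u))
      unflipped (inj₁ (nu , moved)) =
        moved (fixed-spreads nu refl refl (point-∈ 𝒞 (proj₁ nu)) (point-∈ 𝒞 (proj₁ (proj₂ nu))) fixed)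
      unflipped (inj₂ (nu , moved)) =
        moved (fixed-spreads nu refl refl (point-∈ 𝒞 (proj₁ nu)) (point-∈ 𝒞 (proj₁ (proj₂ nu))) (fixed-transposes fixed))
    ... | inj₂ (nu , flipped) =
      trans flipped (sym (trans (F.f-colour refl refl) (cong (λ b → flipIf 𝒞 b _) (from F.edge≡true⇔ (inj₁ (nu , moved))))))
      where
      moved : f (c (point 𝒞 (c u u)) (point 𝒞 (c v v))) ≢ c (point 𝒞 (c u u)) (point 𝒞 (c v v))
      moved fixed = Coordinates.other≢ 𝒞 (type2K22 𝒞 irr nu) refl refl
        (trans (sym flipped) (fixed-spreads nu (point-∈ 𝒞 (proj₁ nu)) (point-∈ 𝒞 (proj₁ (proj₂ nu))) refl refl fixed))

-- Words of generators

least : ∀ {k} {P : Fin k → Set} → Decidable P → ∃ P → Σ (Fin k) λ i → P i × (∀ j → P j → i ≤ j)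
least {ℕ.suc k} P? (i , pi) with P? zero
... | yes p₀ = zero , p₀ , λ _ _ → ℕ.z≤n
least {ℕ.suc k} P? (zero , p₀) | no ¬p₀ = contradiction p₀ ¬p₀
least {ℕ.suc k} P? (suc i , pi) | no ¬p₀ with least (P? ∘ suc) (i , pi)
... | j , pj , j-least = suc j , pj , λ { zero p₀ → contradiction p₀ ¬p₀ ; (suc l) pl → ℕ.s≤s (j-least l pl) }

module _ (𝒞 : CC) (irr : Irredundant 𝒞) where
  open CC 𝒞

  genEdge : Gen 𝒞 → Fin m → Fin m → Bool
  genEdge g = EdgeFlip.edge 𝒞 irr (genS 𝒞 g) (genS? 𝒞 g) (genS⇒nonUniform 𝒞 irr g)

  flips : List (Gen 𝒞) → Fin m → Fin m → Bool
  flips []       A B = false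
  flips (g ∷ gs) A B = genEdge g A B xor flips gs A B

  flips-++ : ∀ gs hs A B → flips (gs ++ hs) A B ≡ flips gs A B xor flips hs A B
  flips-++ []       hs A B = refl
  flips-++ (g ∷ gs) hs A B = trans (cong (genEdge g A B xor_) (flips-++ gs hs A B)) (sym (xor-assoc (genEdge g A B) _ _))

  flips-concat : ∀ {k} (gss : Fin k → List (Gen 𝒞)) A B → flips (concat (tabulate gss)) A B ≡ ⨁ λ i → flips (gss i) A B
  flips-concat {ℕ.zero}  gss A B = refl
  flips-concat {ℕ.suc k} gss A B = trans (flips-++ (gss zero) _ A B) (cong (flips (gss zero) A B xor_) (flips-concat (gss ∘ suc) A B))

  word≡flipIf : ∀ ws j → word 𝒞 ws j ≡ flipIf 𝒞 (flips ws (src 𝒞 j) (tgt 𝒞 j)) j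
  word≡flipIf []       j = refl
  word≡flipIf (g ∷ gs) j = begin
    fGen 𝒞 g (word 𝒞 gs j)                          ≡⟨ cong (fGen 𝒞 g) (word≡flipIf gs j) ⟩
    fGen 𝒞 g (flipIf 𝒞 e j)                         ≡⟨ cong₂ (λ A B → flipIf 𝒞 (genEdge g A B) (flipIf 𝒞 e j))
                                                              (flipIf-src 𝒞 e j) (flipIf-tgt 𝒞 e j) ⟩
    flipIf 𝒞 (genEdge g (src 𝒞 j) (tgt 𝒞 j)) (flipIf 𝒞 e j) ≡⟨ flipIf-flipIf 𝒞 irr _ e j genEdge⇒nonUniform ⟩
    flipIf 𝒞 (flips (g ∷ gs) (src 𝒞 j) (tgt 𝒞 j)) j ∎
    where
    open ≡-Reasoning
    e = flips gs (src 𝒞 j) (tgt 𝒞 j)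
    genEdge⇒nonUniform = EdgeFlip.edge⇒nonUniform 𝒞 irr (genS 𝒞 g) (genS? 𝒞 g) (genS⇒nonUniform 𝒞 irr g)

  Canonical : Fin m → Fin m → Set
  Canonical Y Z = NonUniform 𝒞 Y Z × (∀ W → Class 𝒞 Y Z W → Y ≤ W) × (∀ W → Class 𝒞 Y Z W → W ≢ Y → Z ≤ W)

  Canonical? : ∀ Y Z → Dec (Canonical Y Z)
  Canonical? Y Z = NonUniform? 𝒞 Y Z ×-dec (all? λ W → Class? 𝒞 Y Z W →-dec Y ≤? W)
                                     ×-dec (all? λ W → Class? 𝒞 Y Z W →-dec ¬? (W ≟ Y) →-dec Z ≤? W)

  private
    base∈ : ∀ {Y Z} → Class 𝒞 Y Z Y
    base∈ = inj₁ refl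

    partner∈ : ∀ {Y Z} → NonUniform 𝒞 Y Z → Class 𝒞 Y Z Z
    partner∈ nu = inj₂ (NonUniform-sym 𝒞 nu , Connected-refl 𝒞)

  canonical-pair : ∀ {A B} → NonUniform 𝒞 A B →
                   Σ (Fin m) λ Y → Σ (Fin m) λ Z → Canonical Y Z × Class 𝒞 Y Z A × Class 𝒞 Y Z B
  canonical-pair {A} {B} nu = Y , Z , (nuYZ , Y-least′ , Z-least′) , to (same-class A) base∈ , to (same-class B) (partner∈ nu)
    where
    first = least (Class? 𝒞 A B) (A , base∈)
    Y = proj₁ first
    Y∈ = proj₁ (proj₂ first)
    Y-least = proj₂ (proj₂ first)
    other-than-Y : ∃ λ W → Class 𝒞 A B W × W ≢ Y
    other-than-Y with A ≟ Y
    ... | yes A≡Y = B , partner∈ nu , λ B≡Y → NonUniform-irrefl 𝒞 (subst (NonUniform 𝒞 A) (trans B≡Y (sym A≡Y)) nu)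
    ... | no A≢Y  = A , base∈ , A≢Y
    second = least (λ W → Class? 𝒞 A B W ×-dec ¬? (W ≟ Y)) other-than-Y
    Z = proj₁ second
    Z∈ = proj₁ (proj₁ (proj₂ second))
    Z≢Y = proj₂ (proj₁ (proj₂ second))
    Z-least = proj₂ (proj₂ second)
    same-class : ∀ W → Class 𝒞 A B W ⇔ Class 𝒞 Y Z W
    same-class = class-determined 𝒞 irr Y∈ Z∈ (Z≢Y ∘ sym)
    nuYZ = class-nonUniform 𝒞 irr Y∈ Z∈ (Z≢Y ∘ sym)
    Y-least′ : ∀ W → Class 𝒞 Y Z W → Y ≤ W
    Y-least′ W W∈ = Y-least W (from (same-class W) W∈)
    Z-least′ : ∀ W → Class 𝒞 Y Z W → W ≢ Y → Z ≤ W
    Z-least′ W W∈ W≢Y = Z-least W (from (same-class W) W∈ , W≢Y)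

  canonical-unique : ∀ {Y Z Y' Z' A B} → Canonical Y Z → Canonical Y' Z' →
                     Class 𝒞 Y Z A → Class 𝒞 Y Z B → Class 𝒞 Y' Z' A → Class 𝒞 Y' Z' B → A ≢ B → Y ≡ Y' × Z ≡ Z'
  canonical-unique {Y} {Z} {Y'} {Z'} (nu , Y-least , Z-least) (nu' , Y'-least , Z'-least) A∈ B∈ A∈' B∈' A≢B =
    Y≡Y' , ≤-antisym (Z-least Z' (from (same-class Z') (partner∈ nu')) (λ Z'≡Y → Z'≢Y' (trans Z'≡Y Y≡Y')))
                     (Z'-least Z (to (same-class Z) (partner∈ nu)) (λ Z≡Y' → Z≢Y (trans Z≡Y' (sym Y≡Y'))))
    where
    same-class : ∀ W → Class 𝒞 Y Z W ⇔ Class 𝒞 Y' Z' W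
    same-class W = ⇔-trans (class-determined 𝒞 irr A∈ B∈ A≢B W) (⇔-sym (class-determined 𝒞 irr A∈' B∈' A≢B W))
    Y≡Y' : Y ≡ Y'
    Y≡Y' = ≤-antisym (Y-least Y' (from (same-class Y') base∈)) (Y'-least Y (to (same-class Y) base∈))
    Z≢Y : Z ≢ Y
    Z≢Y Z≡Y = NonUniform-irrefl 𝒞 (subst (NonUniform 𝒞 Y) Z≡Y nu)
    Z'≢Y' : Z' ≢ Y'
    Z'≢Y' Z'≡Y' = NonUniform-irrefl 𝒞 (subst (NonUniform 𝒞 Y') Z'≡Y' nu')

module Decomposition (𝒞 : CC) (irr : Irredundant 𝒞) (S : Fin (CC.m 𝒞) → Fin (CC.m 𝒞) → Set)
                     (S? : ∀ X Y → Dec (S X Y)) (S⇒nonUniform : ∀ X Y → S X Y → NonUniform 𝒞 X Y)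
                     (cut : EdgeFlip.CutConditions 𝒞 irr S S? S⇒nonUniform) where
  open CC 𝒞
  open EdgeFlip 𝒞 irr S S? S⇒nonUniform

  toGen : ∀ {Y Z X} → Canonical 𝒞 irr Y Z → InD 𝒞 Y Z X → Gen 𝒞
  toGen {Y} {Z} {X} can X∈ = record
    { X = X ; Y = Y ; Z = Z ; nonunif = proj₁ can ; X∈C = X∈ ; C? = InD? 𝒞 irr (proj₁ can) }

  -- Only the canonical pair (Y, Z) of a class contributes, so each class C is treated once, with
  -- f_{X,C} included iff X lies on the other side of the cut than Y.
  generatorsAt : Fin m → Fin m → Fin m → List (Gen 𝒞)
  generatorsAt Y Z X with Canonical? 𝒞 irr Y Z
  ... | no _ = []
  ... | yes can with InD? 𝒞 irr (proj₁ can) X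
  ...   | no _   = []
  ...   | yes X∈ = if edge Y X then toGen can X∈ ∷ [] else []

  StarEdge : Fin m → Fin m → Fin m → Fin m → Fin m → Set
  StarEdge Y Z X A B = (A ≡ X × InD 𝒞 Y Z B × B ≢ X) ⊎ (B ≡ X × InD 𝒞 Y Z A × A ≢ X)

  GeneratorFlips : Fin m → Fin m → Fin m → Fin m → Fin m → Set
  GeneratorFlips Y Z X A B = Canonical 𝒞 irr Y Z × InD 𝒞 Y Z X × edge Y X ≡ true × StarEdge Y Z X A B

  flips-generatorsAt : ∀ Y Z X A B → (flips 𝒞 irr (generatorsAt Y Z X) A B ≡ true) ⇔ GeneratorFlips Y Z X A B
  flips-generatorsAt Y Z X A B with Canonical? 𝒞 irr Y Z
  ... | no ¬can = mk⇔ (λ ()) (λ (can , _) → contradiction can ¬can)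
  ... | yes can with InD? 𝒞 irr (proj₁ can) X
  ...   | no X∉ = mk⇔ (λ ()) (λ (_ , X∈ , _) → contradiction X∈ X∉)
  ...   | yes X∈ with edge Y X
  ...     | false = mk⇔ (λ ()) λ { (_ , _ , () , _) }
  ...     | true  = mk⇔ (λ flipped → can , X∈ , refl , to star⇔ (trans (sym (xor-identityʳ _)) flipped))
                        (λ (_ , _ , _ , star) → trans (xor-identityʳ _) (from star⇔ star))
    where
    g = toGen can X∈
    star⇔ = EdgeFlip.edge≡true⇔ 𝒞 irr (genS 𝒞 g) (genS? 𝒞 g) (genS⇒nonUniform 𝒞 irr g)

  generators : List (Gen 𝒞)
  generators = concat (tabulate λ Y → concat (tabulate λ Z → concat (tabulate λ X → generatorsAt Y Z X)))

  flips-generators : ∀ A B → flips 𝒞 irr generators A B ≡ ⨁ λ Y → ⨁ λ Z → ⨁ λ X → flips 𝒞 irr (generatorsAt Y Z X) A B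
  flips-generators A B =
    trans (flips-concat 𝒞 irr (λ Y → concat (tabulate λ Z → concat (tabulate λ X → generatorsAt Y Z X))) A B)
      (⨁-cong λ Y → trans (flips-concat 𝒞 irr (λ Z → concat (tabulate λ X → generatorsAt Y Z X)) A B)
        (⨁-cong λ Z → flips-concat 𝒞 irr (λ X → generatorsAt Y Z X) A B))

  star-members : ∀ {Y Z X A B} → InD 𝒞 Y Z X → StarEdge Y Z X A B → InD 𝒞 Y Z A × InD 𝒞 Y Z B × A ≢ B
  star-members X∈ (inj₁ (refl , B∈ , B≢X)) = X∈ , B∈ , B≢X ∘ sym
  star-members X∈ (inj₂ (refl , A∈ , A≢X)) = A∈ , X∈ , A≢X

  star-ends : ∀ {Y Z X A B} → StarEdge Y Z X A B → X ≡ A ⊎ X ≡ B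
  star-ends (inj₁ (A≡X , _)) = inj₁ (sym A≡X)
  star-ends (inj₂ (B≡X , _)) = inj₂ (sym B≡X)

  flips≡edge-uniform : ∀ {A B} → ¬ NonUniform 𝒞 A B → flips 𝒞 irr generators A B ≡ edge A B
  flips≡edge-uniform {A} {B} ¬nu = trans (flips-generators A B)
    (trans (⨁-zero (λ Y → ⨁ λ Z → ⨁ λ X → flips 𝒞 irr (generatorsAt Y Z X) A B) λ Y →
            ⨁-zero (λ Z → ⨁ λ X → flips 𝒞 irr (generatorsAt Y Z X) A B) λ Z →
            ⨁-zero (λ X → flips 𝒞 irr (generatorsAt Y Z X) A B) λ X → ¬-not λ flipped →
             let can , X∈ , _ , star = to (flips-generatorsAt Y Z X A B) flipped
                 A∈ , B∈ , A≢B = star-members X∈ star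
                 nu = proj₁ can
             in ¬nu (class-nonUniform 𝒞 irr (to (InD⇔Class 𝒞 irr nu A) A∈) (to (InD⇔Class 𝒞 irr nu B) B∈) A≢B))
           (sym (¬nonUniform⇒edge≡false ¬nu)))

  flips≡edge-nonUniform : ∀ {A B} → NonUniform 𝒞 A B → flips 𝒞 irr generators A B ≡ edge A B
  flips≡edge-nonUniform {A} {B} nu = begin
    flips 𝒞 irr generators A B            ≡⟨ flips-generators A B ⟩
    (⨁ λ Y → ⨁ λ Z → ⨁ λ X → H Y Z X)    ≡⟨ ⨁-single (λ Y → ⨁ λ Z → ⨁ λ X → H Y Z X) Y₀ (λ Y Y≢Y₀ →
                                                  ⨁-zero (λ Z → ⨁ λ X → H Y Z X) λ Z → ⨁-zero (λ X → H Y Z X) λ X →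
                                                  ¬-not (Y≢Y₀ ∘ proj₁ ∘ located)) ⟩
    (⨁ λ Z → ⨁ λ X → H Y₀ Z X)           ≡⟨ ⨁-single (λ Z → ⨁ λ X → H Y₀ Z X) Z₀ (λ Z Z≢Z₀ →
                                                  ⨁-zero (λ X → H Y₀ Z X) λ X → ¬-not (Z≢Z₀ ∘ proj₂ ∘ located)) ⟩
    (⨁ λ X → H Y₀ Z₀ X)                  ≡⟨ ⨁-pair (H Y₀ Z₀) A≢B (λ X X≢A X≢B → ¬-not λ flipped →
                                                  [ X≢A , X≢B ]′ (ends flipped)) ⟩
    H Y₀ Z₀ A xor H Y₀ Z₀ B              ≡⟨ cong₂ _xor_ (at-end A∈ (inj₁ (refl , B∈ , A≢B ∘ sym)))
                                                         (at-end B∈ (inj₂ (refl , A∈ , A≢B))) ⟩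
    edge Y₀ A xor edge Y₀ B              ≡⟨ cong (_xor edge Y₀ B) (edge-sym Y₀ A) ⟩
    edge A Y₀ xor edge Y₀ B              ≡⟨ CutCond⇒triangle (cut Y₀ Z₀ nu₀) A∈ (inj₁ refl) B∈ ⟨
    edge A B                             ∎
    where
    open ≡-Reasoning
    H : Fin m → Fin m → Fin m → Bool
    H Y Z X = flips 𝒞 irr (generatorsAt Y Z X) A B
    A≢B = proj₁ (proj₂ (proj₂ nu))
    pair = canonical-pair 𝒞 irr nu
    Y₀ = proj₁ pair
    Z₀ = proj₁ (proj₂ pair)
    can₀ = proj₁ (proj₂ (proj₂ pair))
    nu₀ = proj₁ can₀
    A∈ = from (InD⇔Class 𝒞 irr nu₀ A) (proj₁ (proj₂ (proj₂ (proj₂ pair))))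
    B∈ = from (InD⇔Class 𝒞 irr nu₀ B) (proj₂ (proj₂ (proj₂ (proj₂ pair))))
    located : ∀ {Y Z X} → H Y Z X ≡ true → Y ≡ Y₀ × Z ≡ Z₀
    located {Y} {Z} {X} flipped =
      let can , X∈ , _ , star = to (flips-generatorsAt Y Z X A B) flipped
          A∈′ , B∈′ , _ = star-members X∈ star
          inClass = λ {W} → to (InD⇔Class 𝒞 irr (proj₁ can) W)
      in canonical-unique 𝒞 irr can can₀ (inClass A∈′) (inClass B∈′)
           (to (InD⇔Class 𝒞 irr nu₀ A) A∈) (to (InD⇔Class 𝒞 irr nu₀ B) B∈) A≢B
    ends : ∀ {X} → H Y₀ Z₀ X ≡ true → X ≡ A ⊎ X ≡ B
    ends {X} flipped = star-ends (proj₂ (proj₂ (proj₂ (to (flips-generatorsAt Y₀ Z₀ X A B) flipped))))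
    at-end : ∀ {X} → InD 𝒞 Y₀ Z₀ X → StarEdge Y₀ Z₀ X A B → H Y₀ Z₀ X ≡ edge Y₀ X
    at-end {X} X∈ star = ≡true⇔⇒≡ (mk⇔ (λ flipped → proj₁ (proj₂ (proj₂ (to (flips-generatorsAt Y₀ Z₀ X A B) flipped))))
                                       (λ edge≡true → from (flips-generatorsAt Y₀ Z₀ X A B) (can₀ , X∈ , edge≡true , star)))

  flips≡edge : ∀ A B → flips 𝒞 irr generators A B ≡ edge A B
  flips≡edge A B = case NonUniform? 𝒞 A B of λ where
    (yes nu)  → flips≡edge-nonUniform {A} {B} nu
    (no ¬nu) → flips≡edge-uniform {A} {B} ¬nu

  word≗f : ∀ j → word 𝒞 generators j ≡ f j
  word≗f j = trans (word≡flipIf 𝒞 irr generators j) (cong (λ b → flipIf 𝒞 b j) (flips≡edge (src 𝒞 j) (tgt 𝒞 j)))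

StrictAlgAut-resp-≗ : ∀ 𝒞 {f g : Fin (CC.m 𝒞) → Fin (CC.m 𝒞)} → (∀ j → f j ≡ g j) → StrictAlgAut 𝒞 f → StrictAlgAut 𝒞 g
StrictAlgAut-resp-≗ 𝒞 {f} {g} f≗g ((f-injective , f-surjective) , pres , fixes) =
  ( (λ {a} {b} ga≡gb → f-injective (trans (f≗g a) (trans ga≡gb (sym (f≗g b)))))
  , (λ y → let x , fx≡y = f-surjective y in x , λ {z} z≡x → trans (sym (f≗g z)) (fx≡y z≡x)) )
  , (λ T R S → trans (pres T R S) (trans (cong₂ (λ a b → p 𝒞 a b (f S)) (f≗g T) (f≗g R)) (cong (p 𝒞 (g T) (g R)) (f≗g S))))
  , (λ j cell → trans (sym (f≗g j)) (fixes j cell))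

strictAlgAut⇒word : ∀ 𝒞 → Irredundant 𝒞 → ∀ f → StrictAlgAut 𝒞 f → ∃[ ws ] (∀ j → f j ≡ word 𝒞 ws j)
strictAlgAut⇒word 𝒞 irr f aut = generators , λ j → trans (f≗fS 𝒞 irr f aut j) (sym (word≗f j))
  where
  S = Flipped 𝒞 irr f aut
  S? = Flipped? 𝒞 irr f aut
  fS-aut : StrictAlgAut 𝒞 (fS 𝒞 S S?)
  fS-aut = StrictAlgAut-resp-≗ 𝒞 (f≗fS 𝒞 irr f aut) aut
  open Decomposition 𝒞 irr S S? (λ _ _ → proj₁) (EdgeFlip.strictAlgAut⇒cut 𝒞 irr S S? (λ _ _ → proj₁) fS-aut)

lemma10p1 : (𝒞 : CC) → Irredundant 𝒞 →
    ((S : Fin (CC.m 𝒞) → Fin (CC.m 𝒞) → Set) → (S? : ∀ X Y → Dec (S X Y)) →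
       (∀ X Y → S X Y → NonUniform 𝒞 X Y) →
       (StrictAlgAut 𝒞 (fS 𝒞 S S?)
         ⇔ (∀ X Y → NonUniform 𝒞 X Y → CutCond 𝒞 S (InD 𝒞 X Y))))
    × ((∀ g → StrictAlgAut 𝒞 (fGen 𝒞 g))
       × (∀ f → StrictAlgAut 𝒞 f → ∃[ ws ] (∀ j → f j ≡ word 𝒞 ws j)))
lemma10p1 𝒞 irr =
  (λ S S? S⇒nonUniform → let open EdgeFlip 𝒞 irr S S? S⇒nonUniform in mk⇔ strictAlgAut⇒cut cut⇒strictAlgAut) ,
  fGen-strictAlgAut 𝒞 irr ,
  strictAlgAut⇒word 𝒞 irr
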